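{- Let $G=(V,E)$ be a graph, $p\colon V\to\mathbb{Z}_{>0}$, $\prec$ a total order on $V$, $v\in V\setminus T$ and $U\subseteq\bar N^+(v)$. The external inequality \[\sum_{u\in U}\frac{1}{\alpha_u}x_{vu}\le\gamma_v\] is valid for $\mathcal P(G,p)$, where $\alpha_u$ denotes the maximum size of a stable set containing $u$ in $G[U]$, $\gamma_v=1$ if $v\in S$, and $\gamma_v=x_{vv}$ otherwise. Moreover, it is facet-defining if $U$ induces a maximal clique.
   Context: $n=|V|$, $\bar E$ is the edge set of the complement of $G$ and $\bar e=|\bar E|$. Let $\bar N^-(w)=\{u\in V: u\prec w,\ \{u,w\}\notin E\}$, $\bar N^+(w)=\{u\in V: w\prec u,\ \{u,w\}\notin E\}$, $\bar N^-[w]=\bar N^-(w)\cup\{w\}$, $S=\{w:\bar N^-(w)=\emptyset\}$, $T=\{w:\bar N^+(w)=\emptyset\}$. Variables: $x_{uw}$ for $w\in V$, $u\in\bar N^-(w)$, and $x_{ww}$ for $w\in V\setminus S$ (so $n+\bar e-|S|$ variables), plus a real variable $y$. $\mathcal K(w)$ is the collection of subsets of $\bar N^+(w)$ inducing a clique of size 2 in $G$ or a maximal clique of size 1 in $G[\bar N^+(w)]$. Constraints: (C1) $\sum_{u\in\bar N^-[w]}x_{uw}\ge1$ for $w\in V\setminus S$; (C2) $\sum_{u\in K}x_{wu}\le x_{ww}$ for $w\in(V\setminus T)\setminus S$, $K\in\mathcal K(w)$; (C3) $\sum_{u\in K}x_{wu}\le 1$ for $w\in(V\setminus T)\cap S$,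 $K\in\mathcal K(w)$; (C4) $p(w)x_{ww}+\sum_{u\in\bar N^+(w)}p(u)x_{wu}\le y$ for $w\in V\setminus S$; (C5) $p(w)+\sum_{u\in\bar N^+(w)}p(u)x_{wu}\le y$ for $w\in S$. $\mathcal P(G,p)=\operatorname{conv}\{(y,x)\in\mathbb{R}_{\ge0}\times\{0,1\}^{n+\bar e-|S|}:(y,x)\text{ satisfies (C1)–(C5)}\}$.
   Formalization: The variable y ranges over the nonnegative rationals instead of the reals, and $\mathcal P(G,p)$ consists of rational points, with convex combinations and affine dimension taken over ℚ. -}

module Defs where

open import Data.Nat as ℕ using (ℕ; zero; suc)
open import Data.Bool using (Bool; true; false; _∧_; _∨_; not; if_then_else_; T)
open import Data.Fin using (Fin; zero; suc)
open import Data.Fin.Properties using () renaming (_≟_ to _≟ᶠ_)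
open import Data.Integer using (+_)
open import Data.Rational using (ℚ; 0ℚ; 1ℚ; _+_; _*_; _≤_; _/_)
open import Data.Product using (Σ; ∃; _×_; _,_)
open import Data.Sum using (_⊎_)
open import Relation.Binary.PropositionalEquality using (_≡_; _≢_)
open import Relation.Binary.Structures using (IsStrictTotalOrder)
open import Relation.Nullary using (¬_)
open import Relation.Nullary.Decidable using (⌊_⌋)

sumℚ : ∀ {k} → (Fin k → ℚ) → ℚ
sumℚ {zero}  f = 0ℚ
sumℚ {suc k} f = f zero + sumℚ (λ i → f (suc i))

count : ∀ {k} → (Fin k → Bool) → ℕ
count {zero}  f = 0
count {suc k} f = (if f zero then 1 else 0) ℕ.+ count (λ i → f (suc i))

allB : ∀ {k} → (Fin k → Bool) → Bool
allB {zero}  f = true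
allB {suc k} f = f zero ∧ allB (λ i → f (suc i))

sumOver : ∀ {k} → (Fin k → Bool) → (Fin k → ℚ) → ℚ
sumOver A f = sumℚ (λ i → if A i then f i else 0ℚ)

ℕ→ℚ : ℕ → ℚ
ℕ→ℚ m = + m / 1

-- 1/m for m ≥ 1 (the value at 0 is never used: α_u ≥ 1 for u ∈ U)
inv : ℕ → ℚ
inv zero    = 0ℚ
inv (suc m) = + 1 / suc m

record Instance (n : ℕ) : Set₁ where
  field
    Adj       : Fin n → Fin n → Bool
    Adj-sym   : ∀ u w → Adj u w ≡ Adj w u
    Adj-irr   : ∀ u → Adj u u ≡ false
    _≺_       : Fin n → Fin n → Set
    ≺-sto     : IsStrictTotalOrder _≡_ _≺_
    p         : Fin n → ℕ
    p-pos     : ∀ u → 1 ℕ.≤ p u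

module _ {n : ℕ} (I : Instance n) where
  open Instance I
  open IsStrictTotalOrder ≺-sto using (_<?_)

  _≺ᵇ_ : Fin n → Fin n → Bool
  u ≺ᵇ w = ⌊ u <? w ⌋

  inNm : Fin n → Fin n → Bool
  inNm w u = (u ≺ᵇ w) ∧ not (Adj u w)

  inNp : Fin n → Fin n → Bool
  inNp w u = (w ≺ᵇ u) ∧ not (Adj w u)

  inS : Fin n → Bool
  inS w = allB (λ u → not (inNm w u))

  inT : Fin n → Bool
  inT w = allB (λ u → not (inNp w u))

  -- the coordinate x_{uw} exists: u ∈ N̄⁻(w), or u = w with w ∉ S
  relevant : Fin n → Fin n → Bool
  relevant u w = inNm w u ∨ (⌊ u ≟ᶠ w ⌋ ∧ not (inS w))

  -- points (y , x) ; x u w stands for x_{uw}; non-existing coordinates are 0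
  Point : Set
  Point = ℚ × (Fin n → Fin n → ℚ)

  Binary : ℚ → Set
  Binary q = q ≡ 0ℚ ⊎ q ≡ 1ℚ

  Feasible : Point → Set
  Feasible (y , x) =
      (0ℚ ≤ y)
    × (∀ u w → T (relevant u w) → Binary (x u w))
    × (∀ u w → relevant u w ≡ false → x u w ≡ 0ℚ)
    × (∀ w → inS w ≡ false →
         1ℚ ≤ x w w + sumOver (inNm w) (λ u → x u w))
    -- (C2), K ∈ 𝒦(w) a clique {a , b} of size 2 of G inside N̄⁺(w)
    × (∀ w → inT w ≡ false → inS w ≡ false → ∀ a b → a ≢ b →
         T (inNp w a) → T (inNp w b) → T (Adj a b) →
         x w a + x w b ≤ x w w)
    -- (C2), K ∈ 𝒦(w) a maximal clique {a} of size 1 of G[N̄⁺(w)]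
    × (∀ w → inT w ≡ false → inS w ≡ false → ∀ a →
         T (inNp w a) → (∀ b → T (inNp w b) → Adj a b ≡ false) →
         x w a ≤ x w w)
    × (∀ w → inT w ≡ false → inS w ≡ true → ∀ a b → a ≢ b →
         T (inNp w a) → T (inNp w b) → T (Adj a b) →
         x w a + x w b ≤ 1ℚ)
    × (∀ w → inT w ≡ false → inS w ≡ true → ∀ a →
         T (inNp w a) → (∀ b → T (inNp w b) → Adj a b ≡ false) →
         x w a ≤ 1ℚ)
    × (∀ w → inS w ≡ false →
         ℕ→ℚ (p w) * x w w + sumOver (inNp w) (λ u → ℕ→ℚ (p u) * x w u) ≤ y)
    × (∀ w → inS w ≡ true →
         ℕ→ℚ (p w) + sumOver (inNp w) (λ u → ℕ→ℚ (p u) * x w u) ≤ y)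

  -- membership in 𝒫(G,p) = conv(feasible points) (rational points)
  InP : Point → Set
  InP (y , x) =
    Σ ℕ λ k → Σ (Fin k → Point) λ q → Σ (Fin k → ℚ) λ λs →
        (∀ i → Feasible (q i))
      × (∀ i → 0ℚ ≤ λs i)
      × (sumℚ λs ≡ 1ℚ)
      × (y ≡ sumℚ (λ i → λs i * Data.Product.proj₁ (q i)))
      × (∀ u w → x u w ≡ sumℚ (λ i → λs i * Data.Product.proj₂ (q i) u w))

  _⊆ᵇ_ : (Fin n → Bool) → (Fin n → Bool) → Set
  A ⊆ᵇ B = ∀ u → T (A u) → T (B u)

  Stable : (Fin n → Bool) → Set
  Stable A = ∀ u w → T (A u) → T (A w) → Adj u w ≡ false

  Clique : (Fin n → Bool) → Set
  Clique A = ∀ u w → T (A u) → T (A w) → u ≢ w → T (Adj u w)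

  MaximalCliqueIn : (Fin n → Bool) → (Fin n → Bool) → Set
  MaximalCliqueIn B A =
      A ⊆ᵇ B × Clique A
    × (∀ w → T (B w) → A w ≡ false → Σ (Fin n) λ u → T (A u) × Adj u w ≡ false)

  IsMaxStableThrough : (Fin n → Bool) → Fin n → ℕ → Set
  IsMaxStableThrough U u a =
      (Σ (Fin n → Bool) λ J → J ⊆ᵇ U × Stable J × T (J u) × count J ≡ a)
    × (∀ J → J ⊆ᵇ U → Stable J → T (J u) → count J ℕ.≤ a)

  AffIndep : ∀ {m} → (Fin m → Point) → Set
  AffIndep {m} q = ∀ (μ : Fin m → ℚ) → sumℚ μ ≡ 0ℚ →
      sumℚ (λ i → μ i * Data.Product.proj₁ (q i)) ≡ 0ℚ →
      (∀ u w → sumℚ (λ i → μ i * Data.Product.proj₂ (q i) u w) ≡ 0ℚ) →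
      ∀ i → μ i ≡ 0ℚ

  HasAffIndep : (Point → Set) → ℕ → Set
  HasAffIndep A m = Σ (Fin m → Point) λ q → (∀ i → A (q i)) × AffIndep q

  Dim : (Point → Set) → ℕ → Set
  Dim A d = HasAffIndep A (suc d) × ¬ HasAffIndep A (suc (suc d))

  ValidP : (Point → ℚ) → (Point → ℚ) → Set
  ValidP lhs rhs = ∀ pt → InP pt → lhs pt ≤ rhs pt

  FacetP : (Point → ℚ) → (Point → ℚ) → Set
  FacetP lhs rhs = ValidP lhs rhs ×
    Σ ℕ λ d → Dim InP (suc d) × Dim (λ pt → InP pt × lhs pt ≡ rhs pt) d

  extLHS : Fin n → (Fin n → Bool) → (Fin n → ℕ) → Point → ℚ
  extLHS v U α (y , x) = sumOver U (λ u → inv (α u) * x v u)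

  γ : Fin n → Point → ℚ
  γ v (y , x) = if inS v then 1ℚ else x v v

-- Validity: at a 0/1 feasible point with x v v = 0 (so v ∉ S), the constraints (C2)
-- of 𝒦(v) force x v u = 0 on N̄⁺(v). Otherwise (C2) or (C3) bound x v a + x v b by 1
-- on every edge of G[N̄⁺(v)], so W = {u ∈ U : x v u = 1} is stable, and as α u ≥ |W|
-- for u ∈ W the left-hand side is at most 1 = γ v. Both sides are affine, so validity
-- passes to the convex hull.
-- Facet: when U is a maximal clique every α u is 1. 𝒫 is full-dimensional in y and
-- the existing x u w, and the face is cut out by an equation solving for x v u₀ for
-- some u₀ ∈ U. The lower bounds on the dimensions come from 0/1 points, one per
-- coordinate, each switching its own coordinate relative to a base point without
-- disturbing the coordinates of lower rank; the upper bounds come from a homogeneous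
-- linear system with more unknowns than equations.

module Submission where

open import Defs
open import Data.Nat as ℕ using (ℕ; zero; suc; z≤n; s≤s)
import Data.Nat.Properties as ℕ
open import Data.Fin using (Fin; zero; suc)
open import Data.Fin.Properties using (suc-injective; any?) renaming (_≟_ to _≟ᶠ_)
open import Data.Bool using (Bool; true; false; _∧_; _∨_; not; if_then_else_; T; T?)
open import Data.Bool.Properties using (T-≡; T-not-≡; T-∧; T-∨)
open import Data.Unit using (tt)
open import Data.Empty using (⊥; ⊥-elim)
open import Data.Product using (Σ; _×_; _,_; proj₁; proj₂)
open import Data.Sum using (_⊎_; inj₁; inj₂)
open import Data.Maybe using (Maybe; just; nothing)
open import Data.List using (List; []; _∷_; length; map; lookup; filter; cartesianProduct; allFin)
import Data.List.Properties as List
open import Data.List.Relation.Unary.All as All using (All; []; _∷_)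
import Data.List.Relation.Unary.All.Properties as All
open import Data.List.Relation.Unary.AllPairs using (_∷_)
open import Data.List.Relation.Unary.Unique.Propositional using (Unique)
import Data.List.Relation.Unary.Unique.Propositional.Properties as Unique
open import Data.List.Relation.Unary.Any using (here; there)
open import Data.List.Membership.Propositional using (_∈_)
open import Data.List.Membership.Propositional.Properties
  using (∈-map⁺; ∈-lookup; ∈-filter⁺; ∈-filter⁻; ∈-cartesianProduct⁺; ∈-allFin)
import Data.Integer as ℤ
open import Data.Nat.Coprimality using (1-coprimeTo) renaming (sym to coprime-sym)
open import Data.Rational
  using (ℚ; 0ℚ; 1ℚ; mkℚ; _+_; _*_; _-_; -_; _≤_; *≤*; 1/_; ≢-nonZero; nonNegative)
import Data.Rational.Properties as ℚ
open import Data.Rational.Solver using (module +-*-Solver)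
open +-*-Solver using (solve; _:+_; _:-_; :-_; _:*_; con; _:=_)
open import Function using (_∘_; id; Equivalence)
open import Relation.Nullary using (¬_; yes; no)
open import Relation.Nullary.Decidable using (⌊_⌋; toWitness; fromWitness; toSum)
open import Relation.Binary.PropositionalEquality
open import Relation.Binary.Structures using (IsStrictTotalOrder)

sumℚ-cong : ∀ {k} {f g : Fin k → ℚ} → (∀ i → f i ≡ g i) → sumℚ f ≡ sumℚ g
sumℚ-cong {zero}  f≗g = refl
sumℚ-cong {suc k} f≗g = cong₂ _+_ (f≗g zero) (sumℚ-cong (λ i → f≗g (suc i)))

sumℚ-0 : ∀ k → sumℚ {k} (λ _ → 0ℚ) ≡ 0ℚ
sumℚ-0 zero    = refl
sumℚ-0 (suc k) = cong (0ℚ +_) (sumℚ-0 k)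

sumℚ-≡0 : ∀ {k} (f : Fin k → ℚ) → (∀ i → f i ≡ 0ℚ) → sumℚ f ≡ 0ℚ
sumℚ-≡0 {k} f f≗0 = trans (sumℚ-cong f≗0) (sumℚ-0 k)

sumℚ-distrib-+ : ∀ {k} (f g : Fin k → ℚ) → sumℚ (λ i → f i + g i) ≡ sumℚ f + sumℚ g
sumℚ-distrib-+ {zero}  f g = refl
sumℚ-distrib-+ {suc k} f g =
  trans (cong ((f zero + g zero) +_) (sumℚ-distrib-+ (λ i → f (suc i)) (λ i → g (suc i))))
        (solve 4 (λ a b c d → (a :+ b) :+ (c :+ d) := (a :+ c) :+ (b :+ d)) refl
               (f zero) (g zero) (sumℚ (λ i → f (suc i))) (sumℚ (λ i → g (suc i))))

sumℚ-*ˡ : ∀ {k} (c : ℚ) (f : Fin k → ℚ) → sumℚ (λ i → c * f i) ≡ c * sumℚ f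
sumℚ-*ˡ {zero}  c f = sym (ℚ.*-zeroʳ c)
sumℚ-*ˡ {suc k} c f = trans (cong (c * f zero +_) (sumℚ-*ˡ c (λ i → f (suc i))))
                            (sym (ℚ.*-distribˡ-+ c (f zero) (sumℚ (λ i → f (suc i)))))

sumℚ-distrib-sub : ∀ {k} (f g : Fin k → ℚ) → sumℚ (λ i → f i - g i) ≡ sumℚ f - sumℚ g
sumℚ-distrib-sub f g = begin
  sumℚ (λ i → f i - g i)            ≡⟨ sumℚ-distrib-+ f (λ i → - g i) ⟩
  sumℚ f + sumℚ (λ i → - g i)       ≡⟨ cong (sumℚ f +_) (sumℚ-cong (λ i → neg≡-1* (g i))) ⟩
  sumℚ f + sumℚ (λ i → - 1ℚ * g i)  ≡⟨ cong (sumℚ f +_) (sumℚ-*ˡ (- 1ℚ) g) ⟩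
  sumℚ f + - 1ℚ * sumℚ g            ≡⟨ cong (sumℚ f +_) (sym (neg≡-1* (sumℚ g))) ⟩
  sumℚ f - sumℚ g                   ∎
  where
  open ≡-Reasoning
  neg≡-1* : ∀ p → - p ≡ - 1ℚ * p
  neg≡-1* = solve 1 (λ p → :- p := :- con 1ℚ :* p) refl

sumℚ-comm : ∀ {k l} (f : Fin k → Fin l → ℚ) →
  sumℚ (λ i → sumℚ (λ j → f i j)) ≡ sumℚ (λ j → sumℚ (λ i → f i j))
sumℚ-comm {zero}  {l} f = sym (sumℚ-0 l)
sumℚ-comm {suc k} {l} f =
  trans (cong (sumℚ (f zero) +_) (sumℚ-comm (λ i → f (suc i))))
        (sym (sumℚ-distrib-+ (f zero) (λ j → sumℚ (λ i → f (suc i) j))))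

sumℚ-single : ∀ {k} (f : Fin k → ℚ) (j : Fin k) → (∀ i → i ≢ j → f i ≡ 0ℚ) → sumℚ f ≡ f j
sumℚ-single {suc k} f zero    f≗0 =
  trans (cong (f zero +_) (sumℚ-≡0 _ (λ i → f≗0 (suc i) (λ ()))))
        (ℚ.+-identityʳ (f zero))
sumℚ-single {suc k} f (suc j) f≗0 =
  trans (cong₂ _+_ (f≗0 zero (λ ()))
                   (sumℚ-single (λ i → f (suc i)) j (λ i i≢j → f≗0 (suc i) (i≢j ∘ suc-injective))))
        (ℚ.+-identityˡ (f (suc j)))

sumℚ-mono-≤ : ∀ {k} {f g : Fin k → ℚ} → (∀ i → f i ≤ g i) → sumℚ f ≤ sumℚ g
sumℚ-mono-≤ {zero}  f≤g = ℚ.≤-refl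
sumℚ-mono-≤ {suc k} f≤g = ℚ.+-mono-≤ (f≤g zero) (sumℚ-mono-≤ (λ i → f≤g (suc i)))

sumℚ-nonNeg : ∀ {k} {f : Fin k → ℚ} → (∀ i → 0ℚ ≤ f i) → 0ℚ ≤ sumℚ f
sumℚ-nonNeg {k} {f} 0≤f = subst (_≤ sumℚ f) (sumℚ-0 k) (sumℚ-mono-≤ {g = f} 0≤f)

term≤sumℚ : ∀ {k} (f : Fin k → ℚ) (j : Fin k) → (∀ i → 0ℚ ≤ f i) → f j ≤ sumℚ f
term≤sumℚ {suc k} f zero    0≤f =
  subst (_≤ sumℚ f) (ℚ.+-identityʳ (f zero))
        (ℚ.+-monoʳ-≤ (f zero) (sumℚ-nonNeg (λ i → 0≤f (suc i))))
term≤sumℚ {suc k} f (suc j) 0≤f =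
  subst (_≤ sumℚ f) (ℚ.+-identityˡ (f (suc j)))
        (ℚ.+-mono-≤ (0≤f zero) (term≤sumℚ (λ i → f (suc i)) j (λ i → 0≤f (suc i))))

p*q≡0⇒p≡0 : ∀ p q → p * q ≡ 0ℚ → q ≢ 0ℚ → p ≡ 0ℚ
p*q≡0⇒p≡0 p q pq≡0 q≢0 = let instance _ = ≢-nonZero q≢0 in begin
  p                  ≡⟨ sym (ℚ.*-identityʳ p) ⟩
  p * 1ℚ             ≡⟨ cong (p *_) (sym (ℚ.*-inverseʳ q)) ⟩
  p * (q * 1/ q)     ≡⟨ sym (ℚ.*-assoc p q (1/ q)) ⟩
  p * q * 1/ q       ≡⟨ cong (_* 1/ q) pq≡0 ⟩
  0ℚ * 1/ q          ≡⟨ ℚ.*-zeroˡ (1/ q) ⟩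
  0ℚ                 ∎
  where open ≡-Reasoning

Row : ℕ → Set
Row m = Fin m → ℚ

dot : ∀ {m} → Row m → Row m → ℚ
dot r μ = sumℚ (λ i → μ i * r i)

-- The last field of pivot says that the rows are r followed by rest, up to order.
data Pivot {m} : List (Row (suc m)) → Set₁ where
  no-pivot : ∀ {rows} → All (λ r → r zero ≡ 0ℚ) rows → Pivot rows
  pivot    : ∀ {rows} (r : Row (suc m)) (rest : List (Row (suc m))) → r zero ≢ 0ℚ →
             suc (length rest) ≡ length rows →
             (∀ {P : Row (suc m) → Set} → P r → All P rest → All P rows) → Pivot rows

pivot? : ∀ {m} (rows : List (Row (suc m))) → Pivot rows
pivot? [] = no-pivot []
pivot? (r ∷ rs) with r zero ℚ.≟ 0ℚ
... | no r₀≢0 = pivot r rs r₀≢0 refl _∷_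
... | yes r₀≡0 with pivot? rs
...   | no-pivot all≡0 = no-pivot (r₀≡0 ∷ all≡0)
...   | pivot r′ rest r′₀≢0 len reorder =
        pivot r′ (r ∷ rest) r′₀≢0 (cong suc len) (λ { Pr′ (Pr ∷ Prest) → Pr ∷ reorder Pr′ Prest })

e₀ : ∀ {m} → Row (suc m)
e₀ zero    = 1ℚ
e₀ (suc i) = 0ℚ

dot-e₀ : ∀ {m} (r : Row (suc m)) → dot r e₀ ≡ r zero
dot-e₀ r = trans (cong₂ _+_ (ℚ.*-identityˡ (r zero)) (sumℚ-≡0 _ (λ i → ℚ.*-zeroˡ (r (suc i)))))
                 (ℚ.+-identityʳ (r zero))

-- Gaussian elimination on column 0, then recursion on the remaining columns.
kernel-nonTrivial : ∀ m (rows : List (Row m)) → length rows ℕ.< m →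
  Σ (Row m) λ μ → All (λ r → dot r μ ≡ 0ℚ) rows × Σ (Fin m) λ i → μ i ≢ 0ℚ
kernel-nonTrivial (suc m) rows len< with pivot? rows
... | no-pivot all≡0 = e₀ , All.map (λ {r} r₀≡0 → trans (dot-e₀ r) r₀≡0) all≡0 , zero , λ ()
... | pivot r rest r₀≢0 len reorder =
      μ , reorder r⊥μ (All.map (λ {ρ} → lift {ρ}) (All.map⁻ (proj₁ (proj₂ ν-sol))))
        , suc (proj₁ (proj₂ (proj₂ ν-sol))) , proj₂ (proj₂ (proj₂ ν-sol))
  where
  instance _ = ≢-nonZero r₀≢0
  c = 1/ (r zero)
  eliminate : Row (suc m) → Row m
  eliminate ρ i = ρ (suc i) - (ρ zero * c) * r (suc i)
  len<′ : length (map eliminate rest) ℕ.< m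
  len<′ = ℕ.≤-pred (subst (ℕ._< suc m) (sym (trans (cong suc (List.length-map eliminate rest)) len)) len<)
  ν-sol = kernel-nonTrivial m (map eliminate rest) len<′
  ν = proj₁ ν-sol
  t = sumℚ (λ i → ν i * r (suc i))
  μ : Row (suc m)
  μ zero    = - (t * c)
  μ (suc i) = ν i
  r⊥μ : dot r μ ≡ 0ℚ
  r⊥μ = begin
    - (t * c) * r zero + t  ≡⟨ solve 3 (λ t c r₀ → :- (t :* c) :* r₀ :+ t := t :* (con 1ℚ :- c :* r₀)) refl t c (r zero) ⟩
    t * (1ℚ - c * r zero)   ≡⟨ cong (λ z → t * (1ℚ - z)) (ℚ.*-inverseˡ (r zero)) ⟩
    t * (1ℚ - 1ℚ)           ≡⟨ ℚ.*-zeroʳ t ⟩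
    0ℚ                      ∎
    where open ≡-Reasoning
  lift : ∀ {ρ} → dot (eliminate ρ) ν ≡ 0ℚ → dot ρ μ ≡ 0ℚ
  lift {ρ} eρ⊥ν = begin
    - (t * c) * ρ zero + s                        ≡⟨ cong (- (t * c) * ρ zero +_) (sym s≡) ⟩
    - (t * c) * ρ zero + (dot (eliminate ρ) ν + k * t) ≡⟨ cong (λ z → - (t * c) * ρ zero + (z + k * t)) eρ⊥ν ⟩
    - (t * c) * ρ zero + (0ℚ + k * t)             ≡⟨ solve 3 (λ t c ρ₀ → :- (t :* c) :* ρ₀ :+ (con 0ℚ :+ (ρ₀ :* c) :* t) := con 0ℚ) refl t c (ρ zero) ⟩
    0ℚ                                            ∎
    where
    open ≡-Reasoning
    k = ρ zero * c
    s = sumℚ (λ i → ν i * ρ (suc i))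
    s≡ : dot (eliminate ρ) ν + k * t ≡ s
    s≡ = begin
      dot (eliminate ρ) ν + k * t
        ≡⟨ cong (_+ k * t) (sumℚ-cong (λ i → solve 4 (λ a b k c → a :* (b :- k :* c) := a :* b :- k :* (a :* c)) refl (ν i) (ρ (suc i)) k (r (suc i)))) ⟩
      sumℚ (λ i → ν i * ρ (suc i) - k * (ν i * r (suc i))) + k * t
        ≡⟨ cong (_+ k * t) (sumℚ-distrib-sub (λ i → ν i * ρ (suc i)) (λ i → k * (ν i * r (suc i)))) ⟩
      s - sumℚ (λ i → k * (ν i * r (suc i))) + k * t
        ≡⟨ cong (λ z → s - z + k * t) (sumℚ-*ˡ k (λ i → ν i * r (suc i))) ⟩
      s - k * t + k * t
        ≡⟨ solve 2 (λ s x → s :- x :+ x := s) refl s (k * t) ⟩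
      s ∎

triangular⇒independent : ∀ {m} {C : Set} (A : Fin m → C → ℚ) (rank : Fin m → ℕ) (c : Fin m → C) →
  (∀ j → A j (c j) ≢ 0ℚ) → (∀ j k → k ≢ j → rank j ℕ.≤ rank k → A k (c j) ≡ 0ℚ) →
  ∀ (μ : Fin m → ℚ) → (∀ x → sumℚ (λ k → μ k * A k x) ≡ 0ℚ) → ∀ j → μ j ≡ 0ℚ
triangular⇒independent {m} A rank c pivot≢0 above≡0 μ μA≡0 j = go (suc (rank j)) j ℕ.≤-refl
  where
  go : ∀ b j → rank j ℕ.< b → μ j ≡ 0ℚ
  go (suc b) j rank<b = p*q≡0⇒p≡0 (μ j) (A j (c j)) μⱼAⱼ≡0 (pivot≢0 j)
    where
    others≡0 : ∀ k → k ≢ j → μ k * A k (c j) ≡ 0ℚ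
    others≡0 k k≢j with rank j ℕ.≤? rank k
    ... | yes j≤k = trans (cong (μ k *_) (above≡0 j k k≢j j≤k)) (ℚ.*-zeroʳ (μ k))
    ... | no  j≰k = trans (cong (_* A k (c j)) (go b k (ℕ.≤-trans (ℕ.≰⇒> j≰k) (ℕ.≤-pred rank<b))))
                          (ℚ.*-zeroˡ (A k (c j)))
    μⱼAⱼ≡0 : μ j * A j (c j) ≡ 0ℚ
    μⱼAⱼ≡0 = trans (sym (sumℚ-single (λ k → μ k * A k (c j)) j others≡0)) (μA≡0 (c j))

Coord : ℕ → Set
Coord n = Maybe (Fin n × Fin n)

coord : ∀ {n} → ℚ × (Fin n → Fin n → ℚ) → Coord n → ℚ
coord (y , x) nothing        = y
coord (y , x) (just (u , w)) = x u w

module _ {n : ℕ} (I : Instance n) where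

  AffIndep-fromDifferences : ∀ {m} (q : Fin (suc m) → Point I) →
    (∀ (μ : Fin m → ℚ) → (∀ c → sumℚ (λ k → μ k * (coord (q (suc k)) c - coord (q zero) c)) ≡ 0ℚ) →
       ∀ k → μ k ≡ 0ℚ) →
    AffIndep I q
  AffIndep-fromDifferences {m} q differences-indep μ Σμ≡0 Σμy≡0 Σμx≡0 = μ≡0
    where
    μ′ : Fin m → ℚ
    μ′ k = μ (suc k)
    Σμ′≡-μ₀ : sumℚ μ′ ≡ - μ zero
    Σμ′≡-μ₀ = trans (solve 2 (λ a s → s := (a :+ s) :- a) refl (μ zero) (sumℚ μ′))
                    (trans (cong (_- μ zero) Σμ≡0) (ℚ.+-identityˡ (- μ zero)))
    Σμc≡0 : ∀ c → sumℚ (λ i → μ i * coord (q i) c) ≡ 0ℚ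
    Σμc≡0 nothing        = Σμy≡0
    Σμc≡0 (just (u , w)) = Σμx≡0 u w
    Σμ′Δ≡0 : ∀ c → sumℚ (λ k → μ′ k * (coord (q (suc k)) c - coord (q zero) c)) ≡ 0ℚ
    Σμ′Δ≡0 c = begin
      sumℚ (λ k → μ′ k * (coord (q (suc k)) c - b))
        ≡⟨ sumℚ-cong (λ k → solve 3 (λ a c d → a :* (c :- d) := a :* c :- d :* a) refl (μ′ k) (coord (q (suc k)) c) b) ⟩
      sumℚ (λ k → μ′ k * coord (q (suc k)) c - b * μ′ k)
        ≡⟨ sumℚ-distrib-sub (λ k → μ′ k * coord (q (suc k)) c) (λ k → b * μ′ k) ⟩
      s - sumℚ (λ k → b * μ′ k)
        ≡⟨ cong (λ z → s - z) (trans (sumℚ-*ˡ b μ′) (cong (b *_) Σμ′≡-μ₀)) ⟩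
      s - b * (- μ zero)
        ≡⟨ solve 3 (λ s b m → s :- b :* (:- m) := m :* b :+ s) refl s b (μ zero) ⟩
      μ zero * b + s
        ≡⟨ Σμc≡0 c ⟩
      0ℚ ∎
      where
      open ≡-Reasoning
      b = coord (q zero) c
      s = sumℚ (λ k → μ′ k * coord (q (suc k)) c)
    μ′≡0 = differences-indep μ′ Σμ′Δ≡0
    μ≡0 : ∀ i → μ i ≡ 0ℚ
    μ≡0 zero    = ℚ.neg-injective (trans (sym Σμ′≡-μ₀) (sumℚ-≡0 μ′ μ′≡0))
    μ≡0 (suc k) = μ′≡0 k

  DeterminedBy : (Point I → Set) → List (Coord n) → Set
  DeterminedBy A L = ∀ {m} (q : Fin m → Point I) → (∀ i → A (q i)) → ∀ (μ : Fin m → ℚ) → sumℚ μ ≡ 0ℚ →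
    (∀ c → c ∈ L → sumℚ (λ i → μ i * coord (q i) c) ≡ 0ℚ) → ∀ c → sumℚ (λ i → μ i * coord (q i) c) ≡ 0ℚ

  -- The condition sumℚ μ ≡ 0 and the coordinates in L are length L + 1 equations on
  -- length L + 2 unknowns, so they have a nontrivial solution.
  ¬HasAffIndep-determinedBy : ∀ (A : Point I → Set) (L : List (Coord n)) →
    DeterminedBy A L → ¬ HasAffIndep I A (suc (suc (length L)))
  ¬HasAffIndep-determinedBy A L determined (q , qA , indep) =
    μᵢ≢0 (indep μ Σμ≡0 (Σμc≡0 nothing) (λ u w → Σμc≡0 (just (u , w))) i)
    where
    m = suc (suc (length L))
    rows : List (Row m)
    rows = (λ _ → 1ℚ) ∷ map (λ c i → coord (q i) c) L
    rows< : length rows ℕ.< m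
    rows< = subst (ℕ._< m) (cong suc (sym (List.length-map (λ c i → coord (q i) c) L))) ℕ.≤-refl
    sol = kernel-nonTrivial m rows rows<
    μ = proj₁ sol
    rows⊥μ = proj₁ (proj₂ sol)
    i = proj₁ (proj₂ (proj₂ sol))
    μᵢ≢0 = proj₂ (proj₂ (proj₂ sol))
    Σμ≡0 : sumℚ μ ≡ 0ℚ
    Σμ≡0 = trans (sumℚ-cong (λ i → sym (ℚ.*-identityʳ (μ i)))) (All.head rows⊥μ)
    Σμc≡0 : ∀ c → sumℚ (λ i → μ i * coord (q i) c) ≡ 0ℚ
    Σμc≡0 = determined q qA μ Σμ≡0 (λ c c∈L → All.lookup (All.map⁻ (All.tail rows⊥μ)) c∈L)

T-∧⁻ : ∀ {a b} → T (a ∧ b) → T a × T b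
T-∧⁻ {a} {b} = Equivalence.to (T-∧ {a} {b})

T-∧⁺ : ∀ {a b} → T a → T b → T (a ∧ b)
T-∧⁺ {a} {b} ta tb = Equivalence.from (T-∧ {a} {b}) (ta , tb)

T-∨⁻ : ∀ {a b} → T (a ∨ b) → T a ⊎ T b
T-∨⁻ {a} {b} = Equivalence.to (T-∨ {a} {b})

T-∨ˡ : ∀ {a b} → T a → T (a ∨ b)
T-∨ˡ {a} {b} ta = Equivalence.from (T-∨ {a} {b}) (inj₁ ta)

T-∨ʳ : ∀ {a b} → T b → T (a ∨ b)
T-∨ʳ {a} {b} tb = Equivalence.from (T-∨ {a} {b}) (inj₂ tb)

T⇒≡true : ∀ {a} → T a → a ≡ true
T⇒≡true {a} = Equivalence.to (T-≡ {a})

≡true⇒T : ∀ {a} → a ≡ true → T a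
≡true⇒T {a} = Equivalence.from (T-≡ {a})

T-not⇒≡false : ∀ {a} → T (not a) → a ≡ false
T-not⇒≡false {a} = Equivalence.to (T-not-≡ {a})

≡false⇒T-not : ∀ {a} → a ≡ false → T (not a)
≡false⇒T-not {a} = Equivalence.from (T-not-≡ {a})

≡false⇒¬T : ∀ {a} → a ≡ false → ¬ T a
≡false⇒¬T refl ()

¬T⇒≡false : ∀ {a} → ¬ T a → a ≡ false
¬T⇒≡false {true}  ¬ta = ⊥-elim (¬ta tt)
¬T⇒≡false {false} ¬ta = refl

¬T-T⇒≢ : ∀ {a b} → ¬ T a → T b → a ≢ b
¬T-T⇒≢ ¬Ta Tb refl = ¬Ta Tb

false-or-T : ∀ a → a ≡ false ⊎ T a
false-or-T false = inj₁ refl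
false-or-T true  = inj₂ tt

find : ∀ {k} (f : Fin k → Bool) → Σ (Fin k) (λ u → T (f u)) ⊎ (∀ u → f u ≡ false)
find f with any? (λ u → T? (f u))
... | yes found = inj₁ found
... | no  none  = inj₂ (λ u → ¬T⇒≡false (λ fu → none (u , fu)))

allB-not≡false⇒∃ : ∀ {k} (f : Fin k → Bool) → allB (λ u → not (f u)) ≡ false → Σ (Fin k) (λ u → T (f u))
allB-not≡false⇒∃ f allB≡false with find f
... | inj₁ found = found
... | inj₂ none  = ⊥-elim (≡false⇒¬T allB≡false (allB-intro (λ u → ≡false⇒T-not (none u))))
  where
  allB-intro : ∀ {k} {g : Fin k → Bool} → (∀ i → T (g i)) → T (allB g)
  allB-intro {zero}  tg = tt
  allB-intro {suc k} tg = T-∧⁺ (tg zero) (allB-intro (λ i → tg (suc i)))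

_=ᵇ_ : ∀ {n} → Fin n → Fin n → Bool
a =ᵇ b = ⌊ a ≟ᶠ b ⌋

=ᵇ-refl : ∀ {n} (a : Fin n) → T (a =ᵇ a)
=ᵇ-refl a = fromWitness refl

=ᵇ⇒≡ : ∀ {n} {a b : Fin n} → T (a =ᵇ b) → a ≡ b
=ᵇ⇒≡ = toWitness

≢⇒=ᵇ≡false : ∀ {n} {a b : Fin n} → a ≢ b → (a =ᵇ b) ≡ false
≢⇒=ᵇ≡false a≢b = ¬T⇒≡false (a≢b ∘ =ᵇ⇒≡)

bool→ℚ : Bool → ℚ
bool→ℚ b = if b then 1ℚ else 0ℚ

bool→ℚ-nonNeg : ∀ b → 0ℚ ≤ bool→ℚ b
bool→ℚ-nonNeg true  = ℚ.nonNegative⁻¹ 1ℚ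
bool→ℚ-nonNeg false = ℚ.≤-refl

bool→ℚ≤1 : ∀ b → bool→ℚ b ≤ 1ℚ
bool→ℚ≤1 true  = ℚ.≤-refl
bool→ℚ≤1 false = ℚ.nonNegative⁻¹ 1ℚ

*bool→ℚ≤ : ∀ a b → 0ℚ ≤ a → a * bool→ℚ b ≤ a
*bool→ℚ≤ a true  0≤a = ℚ.≤-reflexive (ℚ.*-identityʳ a)
*bool→ℚ≤ a false 0≤a = subst (_≤ a) (sym (ℚ.*-zeroʳ a)) 0≤a

bool→ℚ-pair≤ : ∀ (a b : Bool) (g : ℚ) → 0ℚ ≤ g → ¬ (T a × T b) →
  (T a → 1ℚ ≤ g) → (T b → 1ℚ ≤ g) → bool→ℚ a + bool→ℚ b ≤ g
bool→ℚ-pair≤ true  true  g _   ¬both _   _   = ⊥-elim (¬both (tt , tt))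
bool→ℚ-pair≤ true  false g _   _     ta⇒ _   = ta⇒ tt
bool→ℚ-pair≤ false true  g _   _     _   tb⇒ = tb⇒ tt
bool→ℚ-pair≤ false false g 0≤g _     _   _   = 0≤g

bool→ℚ≤ : ∀ (a : Bool) (g : ℚ) → 0ℚ ≤ g → (T a → 1ℚ ≤ g) → bool→ℚ a ≤ g
bool→ℚ≤ true  g _   ta⇒ = ta⇒ tt
bool→ℚ≤ false g 0≤g _   = 0≤g

ℕ→ℚ-nonNeg : ∀ m → 0ℚ ≤ ℕ→ℚ m
ℕ→ℚ-nonNeg m = ℚ.nonNegative⁻¹ (ℕ→ℚ m) {{ℚ.normalize-nonNeg m 1}}

ℕ→ℚ-suc≡mkℚ : ∀ k → ℕ→ℚ (suc k) ≡ mkℚ (ℤ.+ suc k) 0 (coprime-sym (1-coprimeTo (suc k)))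
ℕ→ℚ-suc≡mkℚ k = ℚ.normalize-coprime (coprime-sym (1-coprimeTo (suc k)))

inv-suc≡mkℚ : ∀ k → inv (suc k) ≡ mkℚ (ℤ.+ 1) k (1-coprimeTo (suc k))
inv-suc≡mkℚ k = ℚ.normalize-coprime (1-coprimeTo (suc k))

ℕ→ℚ-suc : ∀ m → ℕ→ℚ (suc m) ≡ 1ℚ + ℕ→ℚ m
ℕ→ℚ-suc zero    = refl
ℕ→ℚ-suc (suc k) rewrite ℕ→ℚ-suc≡mkℚ (suc k) | ℕ→ℚ-suc≡mkℚ k | ℕ.*-identityʳ k =
  sym (ℚ.normalize-coprime (coprime-sym (1-coprimeTo (suc (suc k)))))

ℕ→ℚ*inv≤1 : ∀ m → ℕ→ℚ m * inv m ≤ 1ℚ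
ℕ→ℚ*inv≤1 zero    = ℚ.nonNegative⁻¹ 1ℚ
ℕ→ℚ*inv≤1 (suc k) rewrite ℕ→ℚ-suc≡mkℚ k | inv-suc≡mkℚ k =
  ℚ.≤-reflexive (ℚ.*-inverseʳ (mkℚ (ℤ.+ suc k) 0 (coprime-sym (1-coprimeTo (suc k)))))

inv-antimono : ∀ {a b} → 1 ℕ.≤ b → b ℕ.≤ a → inv a ≤ inv b
inv-antimono {suc a} {suc b} _ (s≤s b≤a) rewrite inv-suc≡mkℚ a | inv-suc≡mkℚ b =
  *≤* (ℤ.+≤+ (s≤s (ℕ.+-monoˡ-≤ 0 b≤a)))

sumℚ-indicator : ∀ {k} (f : Fin k → Bool) c → sumℚ (λ u → if f u then c else 0ℚ) ≡ ℕ→ℚ (count f) * c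
sumℚ-indicator {zero}  f c = sym (ℚ.*-zeroˡ c)
sumℚ-indicator {suc k} f c with f zero
... | true  = begin
  c + sumℚ (λ u → if f (suc u) then c else 0ℚ) ≡⟨ cong (c +_) (sumℚ-indicator (λ i → f (suc i)) c) ⟩
  c + ℕ→ℚ m * c                                ≡⟨ solve 2 (λ c m → c :+ m :* c := (con 1ℚ :+ m) :* c) refl c (ℕ→ℚ m) ⟩
  (1ℚ + ℕ→ℚ m) * c                             ≡⟨ cong (_* c) (sym (ℕ→ℚ-suc m)) ⟩
  ℕ→ℚ (suc m) * c                              ∎
  where
  open ≡-Reasoning
  m = count (λ i → f (suc i))
... | false = trans (ℚ.+-identityˡ _) (sumℚ-indicator (λ i → f (suc i)) c)

count-pos : ∀ {k} (f : Fin k → Bool) u → T (f u) → 1 ℕ.≤ count f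
count-pos {suc k} f zero    fu with f zero
... | true  = s≤s z≤n
count-pos {suc k} f (suc u) fu with f zero
... | true  = s≤s z≤n
... | false = count-pos (λ i → f (suc i)) u fu

sumℚ-split : ∀ {k} (f : Fin k → ℚ) j → sumℚ f ≡ f j + sumℚ (λ u → if u =ᵇ j then 0ℚ else f u)
sumℚ-split f j = begin
  sumℚ f                                                   ≡⟨ sumℚ-cong split ⟩
  sumℚ (λ u → on u + off u)                                ≡⟨ sumℚ-distrib-+ on off ⟩
  sumℚ on + sumℚ off                                       ≡⟨ cong (_+ sumℚ off) (sumℚ-single on j on≡0) ⟩
  on j + sumℚ off                                          ≡⟨ cong (_+ sumℚ off) on-j ⟩
  f j + sumℚ off                                           ∎
  where
  open ≡-Reasoning
  on off : _ → ℚ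
  on  u = if u =ᵇ j then f u else 0ℚ
  off u = if u =ᵇ j then 0ℚ else f u
  split : ∀ u → f u ≡ on u + off u
  split u with u =ᵇ j
  ... | true  = sym (ℚ.+-identityʳ (f u))
  ... | false = sym (ℚ.+-identityˡ (f u))
  on≡0 : ∀ u → u ≢ j → on u ≡ 0ℚ
  on≡0 u u≢j rewrite ≢⇒=ᵇ≡false u≢j = refl
  on-j : on j ≡ f j
  on-j rewrite T⇒≡true (=ᵇ-refl j) = refl

module _ {n : ℕ} (I : Instance n) where
  open Instance I
  open IsStrictTotalOrder ≺-sto using (irrefl)

  ≺ᵇ⇒≢ : ∀ {a b} → T (_≺ᵇ_ I a b) → a ≢ b
  ≺ᵇ⇒≢ a≺b a≡b = irrefl a≡b (toWitness a≺b)

  inNp⇒≢ : ∀ {w a} → T (inNp I w a) → w ≢ a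
  inNp⇒≢ = ≺ᵇ⇒≢ ∘ proj₁ ∘ T-∧⁻

  inNm⇒≢ : ∀ {w u} → T (inNm I w u) → u ≢ w
  inNm⇒≢ = ≺ᵇ⇒≢ ∘ proj₁ ∘ T-∧⁻

  inNm⇒relevant : ∀ {w u} → T (inNm I w u) → T (relevant I u w)
  inNm⇒relevant = T-∨ˡ

  ∉S⇒relevant : ∀ {w} → inS I w ≡ false → T (relevant I w w)
  ∉S⇒relevant {w} w∉S = T-∨ʳ {inNm I w w} (T-∧⁺ (=ᵇ-refl w) (≡false⇒T-not w∉S))

  ∉S⇒∃inNm : ∀ {w} → inS I w ≡ false → Σ (Fin n) (λ u → T (inNm I w u))
  ∉S⇒∃inNm {w} = allB-not≡false⇒∃ (inNm I w)

  ∉T⇒∃inNp : ∀ {w} → inT I w ≡ false → Σ (Fin n) (λ u → T (inNp I w u))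
  ∉T⇒∃inNp {w} = allB-not≡false⇒∃ (inNp I w)

  AdjFree : Fin n → Fin n → Set
  AdjFree a b = a ≡ b ⊎ Adj a b ≡ false

  AdjFree-sym : ∀ {a b} → AdjFree a b → AdjFree b a
  AdjFree-sym (inj₁ a≡b)  = inj₁ (sym a≡b)
  AdjFree-sym {a} {b} (inj₂ ab∉E) = inj₂ (trans (Adj-sym b a) ab∉E)

  boolPoint : ℚ → (Fin n → Fin n → Bool) → Point I
  boolPoint Y B = Y , λ u w → bool→ℚ (B u w)

  -- Twice the total weight: larger than the left-hand side of every (C4) and (C5) at a 0/1 point.
  yBound : ℚ
  yBound = sumℚ (ℕ→ℚ ∘ p) + sumℚ (ℕ→ℚ ∘ p)

  yBound-nonNeg : 0ℚ ≤ yBound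
  yBound-nonNeg = ℚ.+-mono-≤ Σp-nonNeg Σp-nonNeg
    where Σp-nonNeg = sumℚ-nonNeg (λ u → ℕ→ℚ-nonNeg (p u))

  record Admissible (B : Fin n → Fin n → Bool) : Set where
    field
      support-relevant : ∀ u w → T (B u w) → T (relevant I u w)
      covered          : ∀ w → inS I w ≡ false →
                         T (B w w) ⊎ Σ (Fin n) (λ u → T (inNm I w u) × T (B u w))
      out⇒diagonal    : ∀ w a → T (inNp I w a) → T (B w a) → inS I w ≡ true ⊎ T (B w w)
      out-stable       : ∀ w a b → T (inNp I w a) → T (inNp I w b) → T (B w a) → T (B w b) → AdjFree a b

  module _ {B : Fin n → Fin n → Bool} (admissible : Admissible B) where
    open Admissible admissible
    private
      x : Fin n → Fin n → ℚ
      x u w = bool→ℚ (B u w)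

    weighted-row≤ : ∀ w → sumOver (inNp I w) (λ u → ℕ→ℚ (p u) * x w u) ≤ sumℚ (ℕ→ℚ ∘ p)
    weighted-row≤ w = sumℚ-mono-≤ term≤
      where
      term≤ : ∀ u → (if inNp I w u then ℕ→ℚ (p u) * x w u else 0ℚ) ≤ ℕ→ℚ (p u)
      term≤ u with inNp I w u
      ... | true  = *bool→ℚ≤ (ℕ→ℚ (p u)) (B w u) (ℕ→ℚ-nonNeg (p u))
      ... | false = ℕ→ℚ-nonNeg (p u)

    cover≥1 : ∀ w → inS I w ≡ false → 1ℚ ≤ x w w + sumOver (inNm I w) (λ u → x u w)
    cover≥1 w w∉S with covered w w∉S
    ... | inj₁ Bww = subst (_≤ x w w + Σin) (ℚ.+-identityʳ 1ℚ)
                           (ℚ.+-mono-≤ (ℚ.≤-reflexive (sym (cong bool→ℚ (T⇒≡true Bww)))) (sumℚ-nonNeg in-nonNeg))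
      where
      Σin = sumOver (inNm I w) (λ u → x u w)
      in-nonNeg : ∀ u → 0ℚ ≤ (if inNm I w u then x u w else 0ℚ)
      in-nonNeg u with inNm I w u
      ... | true  = bool→ℚ-nonNeg (B u w)
      ... | false = ℚ.≤-refl
    ... | inj₂ (u , u∈N⁻ , Buw) = subst (_≤ x w w + sumℚ f) (ℚ.+-identityˡ 1ℚ)
                                        (ℚ.+-mono-≤ (bool→ℚ-nonNeg (B w w)) (subst (_≤ sumℚ f) fu≡1 (term≤sumℚ f u f-nonNeg)))
      where
      f : Fin n → ℚ
      f u′ = if inNm I w u′ then x u′ w else 0ℚ
      f-nonNeg : ∀ u → 0ℚ ≤ f u
      f-nonNeg u with inNm I w u
      ... | true  = bool→ℚ-nonNeg (B u w)
      ... | false = ℚ.≤-refl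
      fu≡1 : f u ≡ 1ℚ
      fu≡1 rewrite T⇒≡true u∈N⁻ | T⇒≡true Buw = refl

    out⇒xww≥1 : ∀ w a → inS I w ≡ false → T (inNp I w a) → T (B w a) → 1ℚ ≤ x w w
    out⇒xww≥1 w a w∉S a∈N⁺ Bwa with out⇒diagonal w a a∈N⁺ Bwa
    ... | inj₁ w∈S = ⊥-elim (≡false⇒¬T w∉S (≡true⇒T w∈S))
    ... | inj₂ Bww rewrite T⇒≡true Bww = ℚ.≤-refl

    ¬out-both : ∀ w a b → a ≢ b → T (inNp I w a) → T (inNp I w b) → T (Adj a b) → ¬ (T (B w a) × T (B w b))
    ¬out-both w a b a≢b a∈N⁺ b∈N⁺ ab∈E (Bwa , Bwb) with out-stable w a b a∈N⁺ b∈N⁺ Bwa Bwb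
    ... | inj₁ a≡b     = a≢b a≡b
    ... | inj₂ ab∉E    = ≡false⇒¬T ab∉E ab∈E

    admissible⇒feasible : ∀ Y → yBound ≤ Y → Feasible I (boolPoint Y B)
    admissible⇒feasible Y bound≤Y =
        ℚ.≤-trans yBound-nonNeg bound≤Y , binary , irrelevant≡0 , cover≥1
      , (λ w _ w∉S a b a≢b a∈N⁺ b∈N⁺ ab∈E →
           bool→ℚ-pair≤ (B w a) (B w b) (x w w) (bool→ℚ-nonNeg (B w w)) (¬out-both w a b a≢b a∈N⁺ b∈N⁺ ab∈E)
                        (out⇒xww≥1 w a w∉S a∈N⁺) (out⇒xww≥1 w b w∉S b∈N⁺))
      , (λ w _ w∉S a a∈N⁺ _ → bool→ℚ≤ (B w a) (x w w) (bool→ℚ-nonNeg (B w w)) (out⇒xww≥1 w a w∉S a∈N⁺))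
      , (λ w _ _ a b a≢b a∈N⁺ b∈N⁺ ab∈E →
           bool→ℚ-pair≤ (B w a) (B w b) 1ℚ (ℚ.nonNegative⁻¹ 1ℚ) (¬out-both w a b a≢b a∈N⁺ b∈N⁺ ab∈E)
                        (λ _ → ℚ.≤-refl) (λ _ → ℚ.≤-refl))
      , (λ w _ _ a _ _ → bool→ℚ≤1 (B w a))
      , (λ w _ → ℚ.≤-trans (ℚ.+-mono-≤ (ℚ.≤-trans (*bool→ℚ≤ (ℕ→ℚ (p w)) (B w w) (ℕ→ℚ-nonNeg (p w))) (p≤Σp w))
                                       (weighted-row≤ w)) bound≤Y)
      , (λ w _ → ℚ.≤-trans (ℚ.+-mono-≤ (p≤Σp w) (weighted-row≤ w)) bound≤Y)
      where
      p≤Σp : ∀ w → ℕ→ℚ (p w) ≤ sumℚ (ℕ→ℚ ∘ p)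
      p≤Σp w = term≤sumℚ (ℕ→ℚ ∘ p) w (λ u → ℕ→ℚ-nonNeg (p u))
      binary : ∀ u w → T (relevant I u w) → Binary I (x u w)
      binary u w _ with B u w
      ... | true  = inj₂ refl
      ... | false = inj₁ refl
      irrelevant≡0 : ∀ u w → relevant I u w ≡ false → x u w ≡ 0ℚ
      irrelevant≡0 u w irr with B u w in Buw
      ... | true  = ⊥-elim (≡false⇒¬T irr (support-relevant u w (≡true⇒T Buw)))
      ... | false = refl

  feasible⇒InP : ∀ {pt} → Feasible I pt → InP I pt
  feasible⇒InP {y , x} feasible =
    1 , (λ _ → y , x) , (λ _ → 1ℚ) , (λ _ → feasible) , (λ _ → ℚ.nonNegative⁻¹ 1ℚ) ,
    ℚ.+-identityʳ 1ℚ , sym (trans (ℚ.+-identityʳ _) (ℚ.*-identityˡ y)) ,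
    (λ u w → sym (trans (ℚ.+-identityʳ _) (ℚ.*-identityˡ (x u w))))

  InP⇒irrelevant≡0 : ∀ {y x} → InP I (y , x) → ∀ u w → relevant I u w ≡ false → x u w ≡ 0ℚ
  InP⇒irrelevant≡0 (k , q , λs , feasible , _ , _ , _ , x≡) u w irr =
    trans (x≡ u w) (sumℚ-≡0 _ (λ i → trans (cong (λs i *_) (proj₁ (proj₂ (proj₂ (feasible i))) u w irr))
                                         (ℚ.*-zeroʳ (λs i))))

  pairs : List (Fin n × Fin n)
  pairs = cartesianProduct (allFin n) (allFin n)

  pairs-unique : Unique pairs
  pairs-unique = Unique.cartesianProduct⁺ (Unique.allFin⁺ n) (Unique.allFin⁺ n)

  ∈pairs : ∀ a b → (a , b) ∈ pairs
  ∈pairs a b = ∈-cartesianProduct⁺ (∈-allFin a) (∈-allFin b)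

module _ {n : ℕ} (I : Instance n) where
  open Instance I

  Affine : (Point I → ℚ) → Set
  Affine f = ∀ {k} (q : Fin k → Point I) (λs : Fin k → ℚ) y x → sumℚ λs ≡ 1ℚ →
    y ≡ sumℚ (λ i → λs i * proj₁ (q i)) → (∀ u w → x u w ≡ sumℚ (λ i → λs i * proj₂ (q i) u w)) →
    f (y , x) ≡ sumℚ (λ i → λs i * f (q i))

  valid-fromFeasible : ∀ {lhs rhs} → Affine lhs → Affine rhs →
    (∀ pt → Feasible I pt → lhs pt ≤ rhs pt) → ValidP I lhs rhs
  valid-fromFeasible {lhs} {rhs} lhs-affine rhs-affine feasible-valid (y , x) (k , q , λs , feasible , λs-nonNeg , Σλs≡1 , y≡ , x≡) =
    subst₂ _≤_ (sym (lhs-affine q λs y x Σλs≡1 y≡ x≡)) (sym (rhs-affine q λs y x Σλs≡1 y≡ x≡))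
           (sumℚ-mono-≤ (λ i → ℚ.*-monoˡ-≤-nonNeg (λs i) {{nonNegative (λs-nonNeg i)}} (feasible-valid (q i) (feasible i))))

  γ-affine : ∀ v → Affine (γ I v)
  γ-affine v q λs y x Σλs≡1 y≡ x≡ with inS I v
  ... | true  = trans (sym Σλs≡1) (sumℚ-cong (λ i → sym (ℚ.*-identityʳ (λs i))))
  ... | false = x≡ v v

  extLHS-affine : ∀ v U α → Affine (extLHS I v U α)
  extLHS-affine v U α q λs y x Σλs≡1 y≡ x≡ =
    trans (sumℚ-cong termwise)
          (trans (sym (sumℚ-comm (λ i u → λs i * F i u))) (sumℚ-cong (λ i → sumℚ-*ˡ (λs i) (F i))))
    where
    F : _ → Fin n → ℚ
    F i u = if U u then inv (α u) * proj₂ (q i) v u else 0ℚ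
    termwise : ∀ u → (if U u then inv (α u) * x v u else 0ℚ) ≡ sumℚ (λ i → λs i * F i u)
    termwise u with U u
    ... | false = sym (sumℚ-≡0 _ (λ i → ℚ.*-zeroʳ (λs i)))
    ... | true  = trans (cong (inv (α u) *_) (x≡ v u))
                 (trans (sym (sumℚ-*ˡ (inv (α u)) (λ i → λs i * proj₂ (q i) v u)))
                        (sumℚ-cong (λ i → solve 3 (λ a l b → a :* (l :* b) := l :* (a :* b)) refl
                                                  (inv (α u)) (λs i) (proj₂ (q i) v u))))

module _ {n : ℕ} (I : Instance n) (U : Fin n → Bool) (α : Fin n → ℕ)
         (α-max : ∀ u → T (U u) → IsMaxStableThrough I U u (α u)) where

  -- Every u ∈ J lies in the stable set J, so α u ≥ |J| and 1/α u ≤ 1/|J|.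
  stable⇒Σinv-α≤1 : ∀ J → _⊆ᵇ_ I J U → Stable I J → sumℚ (λ u → if J u then inv (α u) else 0ℚ) ≤ 1ℚ
  stable⇒Σinv-α≤1 J J⊆U J-stable = begin
    sumℚ (λ u → if J u then inv (α u) else 0ℚ)    ≤⟨ sumℚ-mono-≤ termwise ⟩
    sumℚ (λ u → if J u then inv (count J) else 0ℚ) ≡⟨ sumℚ-indicator J (inv (count J)) ⟩
    ℕ→ℚ (count J) * inv (count J)                  ≤⟨ ℕ→ℚ*inv≤1 (count J) ⟩
    1ℚ                                            ∎
    where
    open ℚ.≤-Reasoning
    termwise : ∀ u → (if J u then inv (α u) else 0ℚ) ≤ (if J u then inv (count J) else 0ℚ)
    termwise u with J u in Ju
    ... | false = ℚ.≤-refl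
    ... | true  = inv-antimono (count-pos J u (≡true⇒T Ju))
                               (proj₂ (α-max u (J⊆U u (≡true⇒T Ju))) J J⊆U J-stable (≡true⇒T Ju))

  module _ (v : Fin n) (U⊆N⁺ : _⊆ᵇ_ I U (inNp I v)) (x : Fin n → Fin n → ℚ)
           (binary : ∀ u w → T (relevant I u w) → Binary I (x u w)) where
    open Instance I

    PairBound : ℚ → Set
    PairBound g = ∀ a b → a ≢ b → T (inNp I v a) → T (inNp I v b) → T (Adj a b) → x v a + x v b ≤ g

    ones : Fin n → Bool
    ones u = U u ∧ ⌊ x v u ℚ.≟ 1ℚ ⌋

    ones⊆U : _⊆ᵇ_ I ones U
    ones⊆U u = proj₁ ∘ T-∧⁻

    ones≡1 : ∀ u → T (ones u) → x v u ≡ 1ℚ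
    ones≡1 u = toWitness ∘ proj₂ ∘ T-∧⁻ {U u}

    extLHS≡Σones : ∀ {y} → extLHS I v U α (y , x) ≡ sumℚ (λ u → if ones u then inv (α u) else 0ℚ)
    extLHS≡Σones = sumℚ-cong termwise
      where
      termwise : ∀ u → (if U u then inv (α u) * x v u else 0ℚ) ≡ (if ones u then inv (α u) else 0ℚ)
      termwise u with U u in Uu
      ... | false = refl
      ... | true with x v u ℚ.≟ 1ℚ
      ...   | yes x≡1 = trans (cong (inv (α u) *_) x≡1) (ℚ.*-identityʳ _)
      ...   | no  x≢1 with binary v u (inNm⇒relevant I (U⊆N⁺ u (≡true⇒T Uu)))
      ...     | inj₁ x≡0 = trans (cong (inv (α u) *_) x≡0) (ℚ.*-zeroʳ (inv (α u)))
      ...     | inj₂ x≡1 = ⊥-elim (x≢1 x≡1)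

    ones-stable : PairBound 1ℚ → Stable I ones
    ones-stable pair≤1 a b a∈ b∈ with a ≟ᶠ b
    ... | yes refl = Adj-irr a
    ... | no  a≢b with Adj a b in ab
    ...   | false = refl
    ...   | true  = ⊥-elim (ℚ.≤⇒≤ᵇ (subst₂ (λ s t → s + t ≤ 1ℚ) (ones≡1 a a∈) (ones≡1 b b∈)
                      (pair≤1 a b a≢b (U⊆N⁺ a (ones⊆U a a∈)) (U⊆N⁺ b (ones⊆U b b∈)) (≡true⇒T ab))))

    -- Every a ∈ N̄⁺(v) lies in a constraint (C2) of 𝒦(v), of size 2 if it has a
    -- neighbour in N̄⁺(v) and of size 1 otherwise; with x v v = 0 it forces x v a = 0.
    ones-empty : x v v ≡ 0ℚ → PairBound (x v v) →
      (∀ a → T (inNp I v a) → (∀ b → T (inNp I v b) → Adj a b ≡ false) → x v a ≤ x v v) →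
      ∀ u → ¬ T (ones u)
    ones-empty xvv≡0 pair≤ single≤ u u∈ with find (λ b → inNp I v b ∧ Adj u b)
    ... | inj₁ (b , b∈N⁺∧ub∈E) = ℚ.≤⇒≤ᵇ (ℚ.≤-trans (1≤1+x (x v b) (nonNeg (binary v b (inNm⇒relevant I b∈N⁺))))
                                       (subst₂ (λ s t → s + x v b ≤ t) (ones≡1 u u∈) xvv≡0
                                               (pair≤ u b u≢b (U⊆N⁺ u (ones⊆U u u∈)) b∈N⁺ ub∈E)))
      where
      b∈N⁺ = proj₁ (T-∧⁻ b∈N⁺∧ub∈E)
      ub∈E = proj₂ (T-∧⁻ {inNp I v b} b∈N⁺∧ub∈E)
      u≢b : u ≢ b
      u≢b refl = ≡false⇒¬T (Adj-irr u) ub∈E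
      nonNeg : ∀ {q} → Binary I q → 0ℚ ≤ q
      nonNeg (inj₁ refl) = ℚ.≤-refl
      nonNeg (inj₂ refl) = ℚ.nonNegative⁻¹ 1ℚ
      1≤1+x : ∀ q → 0ℚ ≤ q → 1ℚ ≤ 1ℚ + q
      1≤1+x q 0≤q = subst (_≤ 1ℚ + q) (ℚ.+-identityʳ 1ℚ) (ℚ.+-monoʳ-≤ 1ℚ 0≤q)
    ... | inj₂ no-neighbour = ℚ.≤⇒≤ᵇ (subst₂ _≤_ (ones≡1 u u∈) xvv≡0
            (single≤ u (U⊆N⁺ u (ones⊆U u u∈))
                     (λ b b∈N⁺ → ¬T⇒≡false (λ ub∈E → ≡false⇒¬T (no-neighbour b) (T-∧⁺ b∈N⁺ ub∈E)))))

  feasible⇒extLHS≤γ : ∀ v → inT I v ≡ false → _⊆ᵇ_ I U (inNp I v) →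
    ∀ pt → Feasible I pt → extLHS I v U α pt ≤ γ I v pt
  feasible⇒extLHS≤γ v v∉T U⊆N⁺ (y , x) (_ , binary , _ , _ , c2-pair , c2-single , c3-pair , _ , _ , _)
    with inS I v in v∈S?
  ... | true  = subst (_≤ 1ℚ) (sym (extLHS≡Σones v U⊆N⁺ x binary {y}))
                      (stable⇒Σinv-α≤1 _ (ones⊆U v U⊆N⁺ x binary) (ones-stable v U⊆N⁺ x binary (c3-pair v v∉T v∈S?)))
  ... | false with binary v v (∉S⇒relevant I v∈S?)
  ...   | inj₂ xvv≡1 = subst₂ _≤_ (sym (extLHS≡Σones v U⊆N⁺ x binary {y})) (sym xvv≡1)
                              (stable⇒Σinv-α≤1 _ (ones⊆U v U⊆N⁺ x binary)
                                 (ones-stable v U⊆N⁺ x binary (λ a b a≢b a∈ b∈ ab∈E →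
                                    subst (x v a + x v b ≤_) xvv≡1 (c2-pair v v∉T v∈S? a b a≢b a∈ b∈ ab∈E))))
  ...   | inj₁ xvv≡0 = subst₂ _≤_ (sym (trans (extLHS≡Σones v U⊆N⁺ x binary {y}) (sumℚ-≡0 _ none))) (sym xvv≡0) ℚ.≤-refl
    where
    none : ∀ u → (if ones v U⊆N⁺ x binary u then inv (α u) else 0ℚ) ≡ 0ℚ
    none u with ones v U⊆N⁺ x binary u in u∈
    ... | false = refl
    ... | true  = ⊥-elim (ones-empty v U⊆N⁺ x binary xvv≡0 (c2-pair v v∉T v∈S?) (c2-single v v∉T v∈S?)
                                     u (≡true⇒T u∈))

  external-valid : ∀ v → inT I v ≡ false → _⊆ᵇ_ I U (inNp I v) → ValidP I (extLHS I v U α) (γ I v)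
  external-valid v v∉T U⊆N⁺ =
    valid-fromFeasible I (extLHS-affine I v U α) (γ-affine I v) (feasible⇒extLHS≤γ v v∉T U⊆N⁺)

lookup-injective : ∀ {A : Set} {xs : List A} → Unique xs → ∀ i j → lookup xs i ≡ lookup xs j → i ≡ j
lookup-injective (_ ∷ _)         zero    zero    _  = refl
lookup-injective (x∉xs ∷ _)      zero    (suc j) eq = ⊥-elim (All.lookup x∉xs (∈-lookup j) eq)
lookup-injective (x∉xs ∷ _)      (suc i) zero    eq = ⊥-elim (All.lookup x∉xs (∈-lookup i) (sym eq))
lookup-injective (_ ∷ unique)    (suc i) (suc j) eq = cong suc (lookup-injective unique i j eq)

Matrix : ℕ → Set
Matrix n = Fin n → Fin n → Bool

at : ∀ {n} → Matrix n → Fin n × Fin n → Bool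
at B (u , w) = B u w

module _ {n : ℕ} (I : Instance n) where

  family : (L : List (Fin n × Fin n)) (Y : ℚ) (base : Matrix n) (B : Fin n × Fin n → Matrix n) →
           Fin (suc (suc (length L))) → Point I
  family L Y base B zero          = boolPoint I Y base
  family L Y base B (suc zero)    = boolPoint I (Y + 1ℚ) base
  family L Y base B (suc (suc j)) = boolPoint I Y (B (lookup L j))

  family-AffIndep : ∀ (L : List (Fin n × Fin n)) Y base B → Unique L → (rank : Fin n × Fin n → ℕ) →
    (∀ c → c ∈ L → at (B c) c ≢ at base c) →
    (∀ c c′ → c ∈ L → c′ ∈ L → c′ ≢ c → rank c ℕ.≤ rank c′ → at (B c′) c ≡ at base c) →
    AffIndep I (family L Y base B)
  family-AffIndep L Y base B unique rank B≢base B≡base =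
    AffIndep-fromDifferences I (family L Y base B)
      (triangular⇒independent Δ rank′ pivotCoord Δ≢0 Δ≡0)
    where
    q = family L Y base B
    Δ : Fin (suc (length L)) → Coord n → ℚ
    Δ k c = coord (q (suc k)) c - coord (q zero) c
    rank′ : Fin (suc (length L)) → ℕ
    rank′ zero    = 0
    rank′ (suc j) = rank (lookup L j)
    pivotCoord : Fin (suc (length L)) → Coord n
    pivotCoord zero    = nothing
    pivotCoord (suc j) = just (lookup L j)
    bool→ℚ-diff≢0 : ∀ a b → a ≢ b → bool→ℚ a - bool→ℚ b ≢ 0ℚ
    bool→ℚ-diff≢0 true  true  a≢b _  = a≢b refl
    bool→ℚ-diff≢0 true  false _   ()
    bool→ℚ-diff≢0 false true  _   ()
    bool→ℚ-diff≢0 false false a≢b _  = a≢b refl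
    Δ≢0 : ∀ j → Δ j (pivotCoord j) ≢ 0ℚ
    Δ≢0 zero    Δ≡0 = ℚ.≤⇒≤ᵇ (ℚ.≤-reflexive (trans (sym (solve 1 (λ y → (y :+ con 1ℚ) :- y := con 1ℚ) refl Y)) Δ≡0))
    Δ≢0 (suc j) = bool→ℚ-diff≢0 _ _ (B≢base (lookup L j) (∈-lookup j))
    Δ≡0 : ∀ j k → k ≢ j → rank′ j ℕ.≤ rank′ k → Δ k (pivotCoord j) ≡ 0ℚ
    Δ≡0 zero    zero    k≢j _   = ⊥-elim (k≢j refl)
    Δ≡0 zero    (suc k) _   _   = ℚ.+-inverseʳ Y
    Δ≡0 (suc j) zero    _   _   = ℚ.+-inverseʳ (bool→ℚ (at base (lookup L j)))
    Δ≡0 (suc j) (suc k) k≢j j≤k =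
      trans (cong (λ b → bool→ℚ b - bool→ℚ (at base (lookup L j)))
                  (B≡base (lookup L j) (lookup L k) (∈-lookup j) (∈-lookup k)
                          (λ eq → k≢j (cong suc (lookup-injective unique k j eq))) j≤k))
            (ℚ.+-inverseʳ (bool→ℚ (at base (lookup L j))))

module _ {n : ℕ} (I : Instance n) (v : Fin n) where
  open Instance I

  -- The 0/1 points used for the facet: the diagonal x w w for w ∉ D, the entries
  -- x v w for w ∈ R and the extra entries E, restricted to the existing coordinates.
  shape : (D R : Fin n → Bool) → Matrix n → Matrix n
  shape D R E u w = (u =ᵇ w ∧ not (D w)) ∨ ((u =ᵇ v ∧ R w) ∨ E u w)

  matrix : (D R : Fin n → Bool) → Matrix n → Matrix n
  matrix D R E u w = relevant I u w ∧ shape D R E u w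

  module ShapeOf (D R : Fin n → Bool) (E : Matrix n) where

    shape-diagonal : ∀ {w} → D w ≡ false → T (shape D R E w w)
    shape-diagonal {w} w∉D = T-∨ˡ (T-∧⁺ (=ᵇ-refl w) (≡false⇒T-not w∉D))

    shape-row : ∀ {w} → T (R w) → T (shape D R E v w)
    shape-row {w} w∈R = T-∨ʳ {v =ᵇ w ∧ not (D w)} (T-∨ˡ (T-∧⁺ (=ᵇ-refl v) w∈R))

    shape-extra : ∀ {u w} → T (E u w) → T (shape D R E u w)
    shape-extra {u} {w} Euw = T-∨ʳ {u =ᵇ w ∧ not (D w)} (T-∨ʳ {u =ᵇ v ∧ R w} Euw)

    shape-cases : ∀ {u w} → T (shape D R E u w) →
      (u ≡ w × D w ≡ false) ⊎ ((u ≡ v × T (R w)) ⊎ T (E u w))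
    shape-cases {u} {w} s with T-∨⁻ {u =ᵇ w ∧ not (D w)} s
    ... | inj₁ diag = inj₁ (=ᵇ⇒≡ (proj₁ (T-∧⁻ diag)) , T-not⇒≡false (proj₂ (T-∧⁻ {u =ᵇ w} diag)))
    ... | inj₂ rest with T-∨⁻ {u =ᵇ v ∧ R w} rest
    ...   | inj₁ row   = inj₂ (inj₁ (=ᵇ⇒≡ (proj₁ (T-∧⁻ row)) , proj₂ (T-∧⁻ {u =ᵇ v} row)))
    ...   | inj₂ extra = inj₂ (inj₂ extra)

    matrix-cases : ∀ {u w} → T (matrix D R E u w) →
      (u ≡ w × D w ≡ false) ⊎ ((u ≡ v × T (R w)) ⊎ T (E u w))
    matrix-cases {u} {w} = shape-cases ∘ proj₂ ∘ T-∧⁻ {relevant I u w}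

    matrix-row : ∀ {w} → T (relevant I v w) → T (R w) → T (matrix D R E v w)
    matrix-row vw-rel w∈R = T-∧⁺ vw-rel (shape-row w∈R)

    matrix-extra : ∀ {u w} → T (relevant I u w) → T (E u w) → T (matrix D R E u w)
    matrix-extra uw-rel Euw = T-∧⁺ uw-rel (shape-extra Euw)

    matrix-diagonal : ∀ {w} → T (relevant I w w) → D w ≡ false → T (matrix D R E w w)
    matrix-diagonal w-rel w∉D = T-∧⁺ w-rel (shape-diagonal w∉D)

  record Consistent (D R : Fin n → Bool) (E : Matrix n) : Set where
    field
      dropped-covered  : ∀ w → inS I w ≡ false → T (D w) →
                         Σ (Fin n) λ u → T (inNm I w u) × ((u ≡ v × T (R w)) ⊎ T (E u w))
      row⇒diagonal    : ∀ a → T (R a) → inS I v ≡ true ⊎ D v ≡ false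
      extra⇒diagonal  : ∀ u a → T (E u a) → T (inNp I u a) → inS I u ≡ true ⊎ D u ≡ false
      row-stable       : ∀ a b → T (R a) → T (R b) → AdjFree I a b
      extra-functional : ∀ u a b → T (E u a) → T (E u b) → a ≡ b
      extra-row-stable : ∀ a b → T (E v a) → T (R b) → AdjFree I a b

  consistent⇒admissible : ∀ {D R E} → Consistent D R E → Admissible I (matrix D R E)
  consistent⇒admissible {D} {R} {E} consistent = record
    { support-relevant = λ u w → proj₁ ∘ T-∧⁻
    ; covered          = covered
    ; out⇒diagonal    = out⇒diagonal
    ; out-stable       = out-stable
    }
    where
    open Consistent consistent
    open ShapeOf D R E
    covered : ∀ w → inS I w ≡ false →
              T (matrix D R E w w) ⊎ Σ (Fin n) (λ u → T (inNm I w u) × T (matrix D R E u w))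
    covered w w∉S with false-or-T (D w)
    ... | inj₁ w∉D = inj₁ (matrix-diagonal (∉S⇒relevant I w∉S) w∉D)
    ... | inj₂ w∈D with dropped-covered w w∉S w∈D
    ...   | u , u∈N⁻ , inj₁ (refl , w∈R) = inj₂ (v , u∈N⁻ , matrix-row (inNm⇒relevant I u∈N⁻) w∈R)
    ...   | u , u∈N⁻ , inj₂ Euw          = inj₂ (u , u∈N⁻ , matrix-extra (inNm⇒relevant I u∈N⁻) Euw)
    keep-diagonal : ∀ w → inS I w ≡ true ⊎ D w ≡ false → inS I w ≡ true ⊎ T (matrix D R E w w)
    keep-diagonal w (inj₁ w∈S) = inj₁ w∈S
    keep-diagonal w (inj₂ w∉D) with false-or-T (inS I w)
    ... | inj₂ w∈S = inj₁ (T⇒≡true w∈S)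
    ... | inj₁ w∉S = inj₂ (matrix-diagonal (∉S⇒relevant I w∉S) w∉D)
    out⇒diagonal : ∀ w a → T (inNp I w a) → T (matrix D R E w a) → inS I w ≡ true ⊎ T (matrix D R E w w)
    out⇒diagonal w a a∈N⁺ Bwa with matrix-cases Bwa
    ... | inj₁ (w≡a , _)            = ⊥-elim (inNp⇒≢ I a∈N⁺ w≡a)
    ... | inj₂ (inj₁ (refl , a∈R)) = keep-diagonal v (row⇒diagonal a a∈R)
    ... | inj₂ (inj₂ Ewa)           = keep-diagonal w (extra⇒diagonal w a Ewa a∈N⁺)
    out-stable : ∀ w a b → T (inNp I w a) → T (inNp I w b) →
                 T (matrix D R E w a) → T (matrix D R E w b) → AdjFree I a b
    out-stable w a b a∈N⁺ b∈N⁺ Bwa Bwb with matrix-cases Bwa | matrix-cases Bwb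
    ... | inj₁ (w≡a , _)            | _                              = ⊥-elim (inNp⇒≢ I a∈N⁺ w≡a)
    ... | _                          | inj₁ (w≡b , _)                 = ⊥-elim (inNp⇒≢ I b∈N⁺ w≡b)
    ... | inj₂ (inj₁ (refl , a∈R)) | inj₂ (inj₁ (_ , b∈R))          = row-stable a b a∈R b∈R
    ... | inj₂ (inj₁ (refl , a∈R)) | inj₂ (inj₂ Evb)                = AdjFree-sym I (extra-row-stable b a Evb a∈R)
    ... | inj₂ (inj₂ Eva)           | inj₂ (inj₁ (refl , b∈R))      = extra-row-stable a b Eva b∈R
    ... | inj₂ (inj₂ Ewa)           | inj₂ (inj₂ Ewb)                = inj₁ (extra-functional w a b Ewa Ewb)

choose : ∀ {k} (f : Fin k → Bool) → Fin k → Fin k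
choose f default with find f
... | inj₁ (u , _) = u
... | inj₂ _       = default

choose-correct : ∀ {k} (f : Fin k → Bool) default → Σ (Fin k) (λ u → T (f u)) → T (f (choose f default))
choose-correct f default (u , fu) with find f
... | inj₁ (_ , fu′) = fu′
... | inj₂ none      = ⊥-elim (≡false⇒¬T (none u) fu)

count-single : ∀ {k} (J : Fin k → Bool) u → T (J u) → (∀ w → w ≢ u → J w ≡ false) → count J ≡ 1
count-single {suc k} J zero    Ju only rewrite T⇒≡true Ju =
  cong suc (count-none (λ i → J (suc i)) (λ i → only (suc i) (λ ())))
  where
  count-none : ∀ {k} (f : Fin k → Bool) → (∀ i → f i ≡ false) → count f ≡ 0
  count-none {zero}  f _    = refl
  count-none {suc k} f none rewrite none zero = count-none (λ i → f (suc i)) (λ i → none (suc i))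
count-single {suc k} J (suc u) Ju only rewrite only zero (λ ()) =
  count-single (λ i → J (suc i)) u Ju (λ w w≢u → only (suc w) (w≢u ∘ suc-injective))

module _ {n : ℕ} (I : Instance n) (U : Fin n → Bool) (α : Fin n → ℕ)
         (α-max : ∀ u → T (U u) → IsMaxStableThrough I U u (α u)) (U-clique : Clique I U) where

  clique⇒α≡1 : ∀ u → T (U u) → α u ≡ 1
  clique⇒α≡1 u u∈U with proj₁ (α-max u u∈U)
  ... | J , J⊆U , J-stable , u∈J , |J|≡αu = trans (sym |J|≡αu) (count-single J u u∈J only-u)
    where
    only-u : ∀ w → w ≢ u → J w ≡ false
    only-u w w≢u = ¬T⇒≡false (λ w∈J → ≡false⇒¬T (J-stable u w u∈J w∈J)
                                              (U-clique u w u∈U (J⊆U w w∈J) (w≢u ∘ sym)))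

single : ∀ {n} → Fin n → Fin n → Matrix n
single a b u w = u =ᵇ a ∧ w =ᵇ b

single-self : ∀ {n} (a b : Fin n) → T (single a b a b)
single-self a b = T-∧⁺ (=ᵇ-refl a) (=ᵇ-refl b)

single-cases : ∀ {n} (a b u w : Fin n) → T (single a b u w) → u ≡ a × w ≡ b
single-cases a b u w s = =ᵇ⇒≡ (proj₁ (T-∧⁻ s)) , =ᵇ⇒≡ (proj₂ (T-∧⁻ {u =ᵇ a} s))

module Construction {n : ℕ} (I : Instance n) (v : Fin n) (U : Fin n → Bool)
  (v∉T : inT I v ≡ false) (U⊆N⁺ : _⊆ᵇ_ I U (inNp I v)) (U-max : MaximalCliqueIn I (inNp I v) U) where
  open Instance I

  non-neighbourInU : ∀ w → T (inNp I v w) → U w ≡ false → Σ (Fin n) λ u → T (U u) × Adj u w ≡ false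
  non-neighbourInU = proj₂ (proj₂ U-max)

  someInU : Σ (Fin n) (λ u → T (U u))
  someInU with ∉T⇒∃inNp I v∉T
  ... | a , a∈N⁺ with U a in Ua
  ...   | true  = a , ≡true⇒T Ua
  ...   | false = proj₁ (non-neighbourInU a a∈N⁺ Ua) , proj₁ (proj₂ (non-neighbourInU a a∈N⁺ Ua))

  u₀ : Fin n
  u₀ = proj₁ someInU

  u₀∈U : T (U u₀)
  u₀∈U = proj₂ someInU

  u₀∈N⁺ : T (inNp I v u₀)
  u₀∈N⁺ = U⊆N⁺ u₀ u₀∈U

  -- An element of N̄⁻(w), whose entry x (cover w) w replaces the dropped diagonal x w w in (C1).
  cover : Fin n → Fin n
  cover w = choose (inNm I w) w

  cover∈N⁻ : ∀ {w} → inS I w ≡ false → T (inNm I w (cover w))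
  cover∈N⁻ {w} w∉S = choose-correct (inNm I w) w (∉S⇒∃inNm I w∉S)

  cover≢ : ∀ {w} → inS I w ≡ false → cover w ≢ w
  cover≢ = inNm⇒≢ I ∘ cover∈N⁻

  partner : Fin n → Fin n
  partner t = choose (λ u → U u ∧ not (Adj u t)) u₀

  partner-correct : ∀ {t} → T (inNp I v t) → U t ≡ false → T (U (partner t)) × Adj t (partner t) ≡ false
  partner-correct {t} t∈N⁺ t∉U = proj₁ (T-∧⁻ chosen) , trans (Adj-sym t (partner t)) (T-not⇒≡false (proj₂ (T-∧⁻ {U (partner t)} chosen)))
    where
    witness = non-neighbourInU t t∈N⁺ t∉U
    chosen = choose-correct (λ u → U u ∧ not (Adj u t)) u₀
               (proj₁ witness , T-∧⁺ (proj₁ (proj₂ witness)) (≡false⇒T-not (proj₂ (proj₂ witness))))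

  -- Row v of the points on the face: t, completed by a non-neighbour in U when t ∉ U,
  -- so that it is stable and meets the clique U exactly once.
  faceRow : Fin n → Fin n → Bool
  faceRow t w = w =ᵇ t ∨ (not (U t) ∧ w =ᵇ partner t)

  faceRow-cases : ∀ {t w} → T (faceRow t w) → w ≡ t ⊎ (U t ≡ false × w ≡ partner t)
  faceRow-cases {t} {w} w∈ with T-∨⁻ {w =ᵇ t} w∈
  ... | inj₁ w=t     = inj₁ (=ᵇ⇒≡ w=t)
  ... | inj₂ partner = inj₂ (T-not⇒≡false (proj₁ (T-∧⁻ partner)) , =ᵇ⇒≡ (proj₂ (T-∧⁻ {not (U t)} partner)))

  faceRow-self : ∀ t → T (faceRow t t)
  faceRow-self t = T-∨ˡ (=ᵇ-refl t)

  faceRow-partner : ∀ t → U t ≡ false → T (faceRow t (partner t))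
  faceRow-partner t t∉U = T-∨ʳ {partner t =ᵇ t} (T-∧⁺ (≡false⇒T-not t∉U) (=ᵇ-refl (partner t)))

  AdjFree-faceRow : ∀ t → T (inNp I v t) → ∀ b → T (faceRow t b) → AdjFree I t b
  AdjFree-faceRow t t∈N⁺ b b∈ with faceRow-cases b∈
  ... | inj₁ refl         = inj₁ refl
  ... | inj₂ (t∉U , refl) = inj₂ (proj₂ (partner-correct t∈N⁺ t∉U))

  faceRow-stable : ∀ t → T (inNp I v t) → ∀ a b → T (faceRow t a) → T (faceRow t b) → AdjFree I a b
  faceRow-stable t t∈N⁺ a b a∈ b∈ with faceRow-cases a∈
  ... | inj₁ refl = AdjFree-faceRow a t∈N⁺ b b∈
  ... | inj₂ (t∉U , refl) with faceRow-cases b∈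
  ...   | inj₁ refl     = AdjFree-sym I (AdjFree-faceRow b t∈N⁺ (partner b) (faceRow-partner b t∉U))
  ...   | inj₂ (_ , refl) = inj₁ refl

  faceRow∩U : ∀ t → T (inNp I v t) →
    Σ (Fin n) λ s → T (U s) × T (faceRow t s) × (∀ u → T (U u) → T (faceRow t u) → u ≡ s)
  faceRow∩U t t∈N⁺ with false-or-T (U t)
  ... | inj₂ t∈U = t , t∈U , faceRow-self t , only
    where
    only : ∀ u → T (U u) → T (faceRow t u) → u ≡ t
    only u u∈U u∈ with faceRow-cases u∈
    ... | inj₁ u≡t        = u≡t
    ... | inj₂ (t∉U , _)  = ⊥-elim (≡false⇒¬T t∉U t∈U)
  ... | inj₁ t∉U = partner t , proj₁ (partner-correct t∈N⁺ t∉U) , faceRow-partner t t∉U , only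
    where
    only : ∀ u → T (U u) → T (faceRow t u) → u ≡ partner t
    only u u∈U u∈ with faceRow-cases u∈
    ... | inj₁ refl       = ⊥-elim (≡false⇒¬T t∉U u∈U)
    ... | inj₂ (_ , u≡p)  = u≡p

  ∅ : Fin n → Bool
  ∅ _ = false

  ∅ₘ : Matrix n
  ∅ₘ _ _ = false

  -- How the point attached to a coordinate (a , b) differs from the base point.
  data CoordKind : Fin n → Fin n → Set where
    irrelevant : ∀ {a b} → relevant I a b ≡ false → CoordKind a b
    diag-v     : inS I v ≡ false → CoordKind v v
    diag-viaV  : ∀ b → b ≢ v → inS I b ≡ false → cover b ≡ v → CoordKind b b
    diag-other : ∀ b → b ≢ v → inS I b ≡ false → cover b ≢ v → CoordKind b b
    row-v      : ∀ b → T (inNp I v b) → CoordKind v b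
    off-row    : ∀ a b → T (inNm I b a) → a ≢ v → CoordKind a b

  kind : ∀ a b → CoordKind a b
  kind a b with false-or-T (relevant I a b)
  ... | inj₁ irr = irrelevant irr
  ... | inj₂ rel with T-∨⁻ {inNm I b a} rel
  ...   | inj₁ a∈N⁻ with a ≟ᶠ v
  ...     | yes refl = row-v b a∈N⁻
  ...     | no  a≢v  = off-row a b a∈N⁻ a≢v
  kind a b | inj₂ rel | inj₂ diag
    with =ᵇ⇒≡ {a = a} {b = b} (proj₁ (T-∧⁻ diag)) | T-not⇒≡false (proj₂ (T-∧⁻ {a =ᵇ b} diag))
  ... | refl | a∉S with a ≟ᶠ v
  ...   | yes refl = diag-v a∉S
  ...   | no  a≢v with cover a ≟ᶠ v
  ...     | yes cover≡v = diag-viaV a a≢v a∉S cover≡v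
  ...     | no  cover≢v = diag-other a a≢v a∉S cover≢v

  dropped : ∀ {a b} → CoordKind a b → Fin n → Bool
  dropped (diag-v _)           w = w =ᵇ v
  dropped (diag-viaV b _ _ _)  w = w =ᵇ b
  dropped (diag-other b _ _ _) w = w =ᵇ b
  dropped _                    w = false

  extra : ∀ {a b} → CoordKind a b → Matrix n
  extra (irrelevant _)       = ∅ₘ
  extra (diag-v _)           = single (cover v) v
  extra (diag-viaV b _ _ _)  = single v b
  extra (diag-other b _ _ _) = single (cover b) b
  extra (row-v b _)          = single v b
  extra (off-row a b _ _)    = single a b

  faceRowOf : ∀ {a b} → CoordKind a b → Fin n → Bool
  faceRowOf (irrelevant _)       = ∅
  faceRowOf (diag-v _)           = ∅
  faceRowOf (diag-viaV b _ _ _)  = faceRow b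
  faceRowOf (diag-other _ _ _ _) = faceRow u₀
  faceRowOf (row-v b _)          = faceRow b
  faceRowOf (off-row _ _ _ _)    = faceRow u₀

  -- Diagonal coordinates come first; among the x v b, those with b ∈ U come last,
  -- since the points for b ∉ U also switch on x v (partner b).
  rank : ∀ {a b} → CoordKind a b → ℕ
  rank (row-v b _)       = if U b then 2 else 1
  rank (off-row _ _ _ _) = 1
  rank _                 = 0

  cover-v∈N⁻ : ∀ b → inS I b ≡ false → cover b ≡ v → T (inNm I b v)
  cover-v∈N⁻ b b∉S cover≡v = subst (λ z → T (inNm I b z)) cover≡v (cover∈N⁻ b∉S)

  single-functional : ∀ (a b u c c′ : Fin n) → T (single a b u c) → T (single a b u c′) → c ≡ c′
  single-functional a b u c c′ s s′ = trans (proj₂ (single-cases a b u c s)) (sym (proj₂ (single-cases a b u c′ s′)))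

  extra-functional : ∀ {a b} (k : CoordKind a b) → ∀ u c c′ → T (extra k u c) → T (extra k u c′) → c ≡ c′
  extra-functional (irrelevant _)       u c c′ ()
  extra-functional (diag-v _)           = single-functional (cover v) v
  extra-functional (diag-viaV b _ _ _)  = single-functional v b
  extra-functional (diag-other b _ _ _) = single-functional (cover b) b
  extra-functional (row-v b _)          = single-functional v b
  extra-functional (off-row a b _ _)    = single-functional a b

  dropped-covered : ∀ {a b} (k : CoordKind a b) → ∀ w → inS I w ≡ false → T (dropped k w) →
    Σ (Fin n) λ u → T (inNm I w u) × T (extra k u w)
  dropped-covered (diag-v _) w w∉S w=v with =ᵇ⇒≡ {a = w} w=v
  ... | refl = cover v , cover∈N⁻ w∉S , single-self (cover v) v
  dropped-covered (diag-viaV b _ _ cover≡v) w w∉S w=b with =ᵇ⇒≡ {a = w} w=b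
  ... | refl = v , cover-v∈N⁻ w w∉S cover≡v , single-self v w
  dropped-covered (diag-other b _ _ _) w w∉S w=b with =ᵇ⇒≡ {a = w} w=b
  ... | refl = cover w , cover∈N⁻ w∉S , single-self (cover w) w

  extra⇒diagonal : ∀ {a b} (k : CoordKind a b) → ∀ u c → T (extra k u c) → T (inNp I u c) →
    inS I u ≡ true ⊎ dropped k u ≡ false
  extra⇒diagonal (irrelevant _) u c ()
  extra⇒diagonal (diag-v v∉S) u c s _ with single-cases (cover v) v u c s
  ... | refl , refl = inj₂ (≢⇒=ᵇ≡false (cover≢ v∉S))
  extra⇒diagonal (diag-viaV b b≢v _ _) u c s _ with single-cases v b u c s
  ... | refl , refl = inj₂ (≢⇒=ᵇ≡false (b≢v ∘ sym))
  extra⇒diagonal (diag-other b _ b∉S _) u c s _ with single-cases (cover b) b u c s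
  ... | refl , refl = inj₂ (≢⇒=ᵇ≡false (cover≢ b∉S))
  extra⇒diagonal (row-v _ _)       u c _ _ = inj₂ refl
  extra⇒diagonal (off-row _ _ _ _) u c _ _ = inj₂ refl

  v∉dropped : ∀ {a b} (k : CoordKind a b) → ∀ c → T (faceRowOf k c) → dropped k v ≡ false
  v∉dropped (irrelevant _)           c ()
  v∉dropped (diag-v _)               c ()
  v∉dropped (diag-viaV b b≢v _ _)  c _ = ≢⇒=ᵇ≡false (b≢v ∘ sym)
  v∉dropped (diag-other b b≢v _ _) c _ = ≢⇒=ᵇ≡false (b≢v ∘ sym)
  v∉dropped (row-v _ _)              c _ = refl
  v∉dropped (off-row _ _ _ _)        c _ = refl

  faceRowOf-stable : ∀ {a b} (k : CoordKind a b) → ∀ c c′ → T (faceRowOf k c) → T (faceRowOf k c′) → AdjFree I c c′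
  faceRowOf-stable (irrelevant _)              c c′ ()
  faceRowOf-stable (diag-v _)                  c c′ ()
  faceRowOf-stable (diag-viaV b _ b∉S cover≡v) = faceRow-stable b (cover-v∈N⁻ b b∉S cover≡v)
  faceRowOf-stable (diag-other _ _ _ _)        = faceRow-stable u₀ u₀∈N⁺
  faceRowOf-stable (row-v b b∈N⁺)              = faceRow-stable b b∈N⁺
  faceRowOf-stable (off-row _ _ _ _)           = faceRow-stable u₀ u₀∈N⁺

  extra-faceRowOf-stable : ∀ {a b} (k : CoordKind a b) → ∀ c c′ → T (extra k v c) → T (faceRowOf k c′) →
    AdjFree I c c′
  extra-faceRowOf-stable (irrelevant _) c c′ ()
  extra-faceRowOf-stable (diag-v _)     c c′ _ ()
  extra-faceRowOf-stable (diag-viaV b _ b∉S cover≡v) c c′ s with single-cases v b v c s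
  ... | _ , refl = AdjFree-faceRow c (cover-v∈N⁻ c b∉S cover≡v) c′
  extra-faceRowOf-stable (diag-other b _ _ cover≢v) c c′ s = ⊥-elim (cover≢v (sym (proj₁ (single-cases (cover b) b v c s))))
  extra-faceRowOf-stable (row-v b b∈N⁺) c c′ s with single-cases v b v c s
  ... | _ , refl = AdjFree-faceRow c b∈N⁺ c′
  extra-faceRowOf-stable (off-row a b _ a≢v) c c′ s = ⊥-elim (a≢v (sym (proj₁ (single-cases a b v c s))))

  consistent-full : ∀ {a b} (k : CoordKind a b) → Consistent I v (dropped k) ∅ (extra k)
  consistent-full k = record
    { dropped-covered  = λ w w∉S w∈D → let (u , u∈N⁻ , Euw) = dropped-covered k w w∉S w∈D in u , u∈N⁻ , inj₂ Euw
    ; row⇒diagonal    = λ _ ()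
    ; extra⇒diagonal  = extra⇒diagonal k
    ; row-stable       = λ _ _ ()
    ; extra-functional = extra-functional k
    ; extra-row-stable = λ _ _ _ ()
    }

  consistent-face : ∀ {a b} (k : CoordKind a b) → Consistent I v (dropped k) (faceRowOf k) (extra k)
  consistent-face k = record
    { dropped-covered  = λ w w∉S w∈D → let (u , u∈N⁻ , Euw) = dropped-covered k w w∉S w∈D in u , u∈N⁻ , inj₂ Euw
    ; row⇒diagonal    = λ c c∈ → inj₂ (v∉dropped k c c∈)
    ; extra⇒diagonal  = extra⇒diagonal k
    ; row-stable       = faceRowOf-stable k
    ; extra-functional = extra-functional k
    ; extra-row-stable = extra-faceRowOf-stable k
    }

  consistent-fullBase : Consistent I v ∅ ∅ ∅ₘ
  consistent-fullBase = record
    { dropped-covered = λ _ _ () ; row⇒diagonal = λ _ () ; extra⇒diagonal = λ _ _ ()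
    ; row-stable = λ _ _ () ; extra-functional = λ _ _ _ () ; extra-row-stable = λ _ _ () }

  consistent-faceBase : Consistent I v ∅ (faceRow u₀) ∅ₘ
  consistent-faceBase = record
    { dropped-covered = λ _ _ () ; row⇒diagonal = λ _ _ → inj₂ refl ; extra⇒diagonal = λ _ _ ()
    ; row-stable = faceRow-stable u₀ u₀∈N⁺ ; extra-functional = λ _ _ _ () ; extra-row-stable = λ _ _ () }

  dropped-only-own : ∀ {a′ b′} (k′ : CoordKind a′ b′) → ∀ w → (a′ , b′) ≢ (w , w) → dropped k′ w ≡ false
  dropped-only-own (irrelevant _)       w _  = refl
  dropped-only-own (diag-v _)           w ≢w = ≢⇒=ᵇ≡false (λ w≡v → ≢w (cong (λ z → z , z) (sym w≡v)))
  dropped-only-own (diag-viaV b _ _ _)  w ≢w = ≢⇒=ᵇ≡false (λ w≡b → ≢w (cong (λ z → z , z) (sym w≡b)))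
  dropped-only-own (diag-other b _ _ _) w ≢w = ≢⇒=ᵇ≡false (λ w≡b → ≢w (cong (λ z → z , z) (sym w≡b)))
  dropped-only-own (row-v _ _)          w _  = refl
  dropped-only-own (off-row _ _ _ _)    w _  = refl

  rank≥1⇒off-diagonal : ∀ {a b} (k : CoordKind a b) → 1 ℕ.≤ rank k → a ≢ b
  rank≥1⇒off-diagonal (row-v b b∈N⁺)      _ = inNp⇒≢ I b∈N⁺
  rank≥1⇒off-diagonal (off-row a b a∈N⁻ _) _ = inNm⇒≢ I a∈N⁻

  off-diagonal⇒rank≥1 : ∀ {a b} (k : CoordKind a b) → T (relevant I a b) → a ≢ b → 1 ℕ.≤ rank k
  off-diagonal⇒rank≥1 (irrelevant irr)     rel _   = ⊥-elim (≡false⇒¬T irr rel)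
  off-diagonal⇒rank≥1 (diag-v _)           _   a≢a = ⊥-elim (a≢a refl)
  off-diagonal⇒rank≥1 (diag-viaV _ _ _ _)  _   a≢a = ⊥-elim (a≢a refl)
  off-diagonal⇒rank≥1 (diag-other _ _ _ _) _   a≢a = ⊥-elim (a≢a refl)
  off-diagonal⇒rank≥1 (row-v b _)          _   _ with U b
  ... | true  = s≤s z≤n
  ... | false = s≤s z≤n
  off-diagonal⇒rank≥1 (off-row _ _ _ _)    _   _   = s≤s z≤n

  extra-only-own : ∀ {a′ b′} (k′ : CoordKind a′ b′) → a′ ≢ b′ → ∀ {u w} → T (extra k′ u w) → (u , w) ≡ (a′ , b′)
  extra-only-own (diag-v _)           a≢a _ = ⊥-elim (a≢a refl)
  extra-only-own (diag-viaV _ _ _ _)  a≢a _ = ⊥-elim (a≢a refl)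
  extra-only-own (diag-other _ _ _ _) a≢a _ = ⊥-elim (a≢a refl)
  extra-only-own (row-v b _)       _ {u} {w} s with single-cases v b u w s
  ... | refl , refl = refl
  extra-only-own (off-row a b _ _) _ {u} {w} s with single-cases a b u w s
  ... | refl , refl = refl

  -- row and row₀ prescribe row v of the points and of the base point; the hypotheses
  -- say that they never switch on a coordinate that the triangular order needs off.
  module Triangular (InL : Fin n × Fin n → Set) (InL⇒relevant : ∀ {a b} → InL (a , b) → T (relevant I a b))
    (row : ∀ {a b} → CoordKind a b → Fin n → Bool) (row₀ : Fin n → Bool)
    (v∉row-diag-v : ∀ v∉S → ¬ T (row (diag-v v∉S) v))
    (row₀-avoids : ∀ {a b} → InL (a , b) → a ≢ b → a ≡ v → ¬ T (row₀ b))
    (row-avoids : ∀ {a b a′ b′} → InL (a , b) → InL (a′ , b′) → (k : CoordKind a b) (k′ : CoordKind a′ b′) →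
                  a ≢ b → a′ ≢ b′ → (a′ , b′) ≢ (a , b) → rank k ℕ.≤ rank k′ → a ≡ v → ¬ T (row k′ b)) where

    pointMatrix : ∀ {a b} → CoordKind a b → Matrix n
    pointMatrix k = matrix I v (dropped k) (row k) (extra k)

    baseMatrix : Matrix n
    baseMatrix = matrix I v ∅ row₀ ∅ₘ

    base-diagonal : ∀ {b} → T (relevant I b b) → T (baseMatrix b b)
    base-diagonal b-rel = ShapeOf.matrix-diagonal I v ∅ row₀ ∅ₘ b-rel refl

    base-off-diagonal : ∀ {a b} → InL (a , b) → a ≢ b → ¬ T (baseMatrix a b)
    base-off-diagonal c∈L a≢b Bab with ShapeOf.matrix-cases I v ∅ row₀ ∅ₘ Bab
    ... | inj₁ (a≡b , _)          = a≢b a≡b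
    ... | inj₂ (inj₁ (a≡v , b∈R)) = row₀-avoids c∈L a≢b a≡v b∈R

    point-cases : ∀ {a b} (k : CoordKind a b) {u w} → T (pointMatrix k u w) →
      (u ≡ w × dropped k w ≡ false) ⊎ ((u ≡ v × T (row k w)) ⊎ T (extra k u w))
    point-cases k = ShapeOf.matrix-cases I v (dropped k) (row k) (extra k)

    point≢base : ∀ {a b} (k : CoordKind a b) → InL (a , b) → pointMatrix k a b ≢ baseMatrix a b
    point≢base (irrelevant irr) c∈L = ⊥-elim (≡false⇒¬T irr (InL⇒relevant c∈L))
    point≢base (diag-v v∉S) c∈L = ¬T-T⇒≢ off (base-diagonal (InL⇒relevant c∈L))
      where
      off : ¬ T (pointMatrix (diag-v v∉S) v v)
      off B with point-cases (diag-v v∉S) B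
      ... | inj₁ (_ , v∉D)         = ≡false⇒¬T v∉D (=ᵇ-refl v)
      ... | inj₂ (inj₁ (_ , v∈R))  = v∉row-diag-v v∉S v∈R
      ... | inj₂ (inj₂ E)          = cover≢ v∉S (sym (proj₁ (single-cases (cover v) v v v E)))
    point≢base k@(diag-viaV b b≢v b∉S cover≡v) c∈L = ¬T-T⇒≢ off (base-diagonal (InL⇒relevant c∈L))
      where
      off : ¬ T (pointMatrix k b b)
      off B with point-cases k B
      ... | inj₁ (_ , b∉D)         = ≡false⇒¬T b∉D (=ᵇ-refl b)
      ... | inj₂ (inj₁ (b≡v , _))  = b≢v b≡v
      ... | inj₂ (inj₂ E)          = b≢v (proj₁ (single-cases v b b b E))
    point≢base k@(diag-other b b≢v b∉S cover≢v) c∈L = ¬T-T⇒≢ off (base-diagonal (InL⇒relevant c∈L))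
      where
      off : ¬ T (pointMatrix k b b)
      off B with point-cases k B
      ... | inj₁ (_ , b∉D)         = ≡false⇒¬T b∉D (=ᵇ-refl b)
      ... | inj₂ (inj₁ (b≡v , _))  = b≢v b≡v
      ... | inj₂ (inj₂ E)          = cover≢ b∉S (sym (proj₁ (single-cases (cover b) b b b E)))
    point≢base k@(row-v b b∈N⁺) c∈L B≡base =
      base-off-diagonal c∈L (inNp⇒≢ I b∈N⁺)
        (subst T B≡base (ShapeOf.matrix-extra I v (dropped k) (row k) (extra k) {v} {b} (InL⇒relevant c∈L) (single-self v b)))
    point≢base k@(off-row a b a∈N⁻ _) c∈L B≡base =
      base-off-diagonal c∈L (inNm⇒≢ I a∈N⁻)
        (subst T B≡base (ShapeOf.matrix-extra I v (dropped k) (row k) (extra k) {a} {b} (InL⇒relevant c∈L) (single-self a b)))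

    point≡base : ∀ {a b} (k : CoordKind a b) {a′ b′} (k′ : CoordKind a′ b′) → InL (a , b) → InL (a′ , b′) →
      (a′ , b′) ≢ (a , b) → rank k ℕ.≤ rank k′ → pointMatrix k′ a b ≡ baseMatrix a b
    point≡base {a} {b} k {a′} {b′} k′ c∈L c′∈L c′≢c k≤k′ with toSum (a ≟ᶠ b)
    ... | inj₁ refl = trans (T⇒≡true (ShapeOf.matrix-diagonal I v (dropped k′) (row k′) (extra k′) (InL⇒relevant c∈L)
                                                     (dropped-only-own k′ a c′≢c)))
                           (sym (T⇒≡true (base-diagonal (InL⇒relevant c∈L))))
    ... | inj₂ a≢b = trans (¬T⇒≡false off) (sym (¬T⇒≡false (base-off-diagonal c∈L a≢b)))
      where
      a′≢b′ : a′ ≢ b′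
      a′≢b′ = rank≥1⇒off-diagonal k′ (ℕ.≤-trans (off-diagonal⇒rank≥1 k (InL⇒relevant c∈L) a≢b) k≤k′)
      off : ¬ T (pointMatrix k′ a b)
      off B with point-cases k′ B
      ... | inj₁ (a≡b , _)          = a≢b a≡b
      ... | inj₂ (inj₁ (a≡v , b∈R)) = row-avoids c∈L c′∈L k k′ a≢b a′≢b′ c′≢c k≤k′ a≡v b∈R
      ... | inj₂ (inj₂ E)           = c′≢c (sym (extra-only-own k′ a′≢b′ E))

    pointOf : Fin n × Fin n → Matrix n
    pointOf (a , b) = pointMatrix (kind a b)

    rankOf : Fin n × Fin n → ℕ
    rankOf (a , b) = rank (kind a b)

    family-indep : (L : List (Fin n × Fin n)) → Unique L → (∀ {c} → c ∈ L → InL c) → ∀ Y →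
      AffIndep I (family I L Y baseMatrix pointOf)
    family-indep L unique L⊆InL Y = family-AffIndep I L Y baseMatrix pointOf unique rankOf
      (λ (a , b) c∈L → point≢base (kind a b) (L⊆InL c∈L))
      (λ (a , b) (a′ , b′) c∈L c′∈L c′≢c ≤ → point≡base (kind a b) (kind a′ b′) (L⊆InL c∈L) (L⊆InL c′∈L) c′≢c ≤)

  -- All coordinates x u w except x v u₀, which the face equation determines.
  faceCoord : Fin n × Fin n → Bool
  faceCoord (a , b) = relevant I a b ∧ not (a =ᵇ v ∧ b =ᵇ u₀)

  coords : List (Fin n × Fin n)
  coords = filter (λ c → T? (faceCoord c)) (pairs I)

  allCoords : List (Fin n × Fin n)
  allCoords = (v , u₀) ∷ coords

  ∈coords⁻ : ∀ {c} → c ∈ coords → T (faceCoord c)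
  ∈coords⁻ c∈ = proj₂ (∈-filter⁻ (λ c → T? (faceCoord c)) {xs = pairs I} c∈)

  ∈coords⁺ : ∀ {a b} → T (relevant I a b) → ¬ (a ≡ v × b ≡ u₀) → (a , b) ∈ coords
  ∈coords⁺ {a} {b} rel ≢vu₀ = ∈-filter⁺ (λ c → T? (faceCoord c)) (∈pairs I a b)
    (T-∧⁺ rel (≡false⇒T-not (¬T⇒≡false (λ both → ≢vu₀ (=ᵇ⇒≡ (proj₁ (T-∧⁻ both)) , =ᵇ⇒≡ (proj₂ (T-∧⁻ {a =ᵇ v} both)))))))

  vu₀∉coords : ∀ {a b} → (a , b) ∈ coords → a ≡ v → b ≡ u₀ → ⊥
  vu₀∉coords c∈ refl refl = ≡false⇒¬T (T-not⇒≡false (proj₂ (T-∧⁻ {relevant I v u₀} (∈coords⁻ c∈))))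
                                       (T-∧⁺ (=ᵇ-refl v) (=ᵇ-refl u₀))

  coords-unique : Unique coords
  coords-unique = Unique.filter⁺ (λ c → T? (faceCoord c)) (pairs-unique I)

  allCoords-unique : Unique allCoords
  allCoords-unique = All.tabulate (λ { c∈ refl → vu₀∉coords c∈ refl refl }) ∷ coords-unique

  coords⇒relevant : ∀ {a b} → (a , b) ∈ coords → T (relevant I a b)
  coords⇒relevant = proj₁ ∘ T-∧⁻ ∘ ∈coords⁻

  allCoords⇒relevant : ∀ {a b} → (a , b) ∈ allCoords → T (relevant I a b)
  allCoords⇒relevant (here refl) = inNm⇒relevant I u₀∈N⁺
  allCoords⇒relevant (there c∈)  = coords⇒relevant c∈

  module FullFamily = Triangular (_∈ allCoords) allCoords⇒relevant (λ _ → ∅) ∅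
                           (λ _ ()) (λ _ _ _ ()) (λ _ _ _ _ _ _ _ _ _ ())

  faceRow₀-avoids : ∀ {a b} → (a , b) ∈ coords → a ≢ b → a ≡ v → ¬ T (faceRow u₀ b)
  faceRow₀-avoids c∈ _ a≡v b∈ with faceRow-cases b∈
  ... | inj₁ b≡u₀       = vu₀∉coords c∈ a≡v b≡u₀
  ... | inj₂ (u₀∉U , _) = ≡false⇒¬T u₀∉U u₀∈U

  rank-row-v∈U : ∀ {b} (k : CoordKind v b) → T (relevant I v b) → v ≢ b → T (U b) → 2 ℕ.≤ rank k
  rank-row-v∈U (irrelevant irr)     rel _   _   = ⊥-elim (≡false⇒¬T irr rel)
  rank-row-v∈U (diag-v _)           _   v≢v _   = ⊥-elim (v≢v refl)
  rank-row-v∈U (diag-viaV _ _ _ _)  _   v≢v _   = ⊥-elim (v≢v refl)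
  rank-row-v∈U (diag-other _ _ _ _) _   v≢v _   = ⊥-elim (v≢v refl)
  rank-row-v∈U (row-v b _)          _   _   b∈U rewrite T⇒≡true b∈U = ℕ.≤-refl
  rank-row-v∈U (off-row _ _ _ v≢v)  _   _   _   = ⊥-elim (v≢v refl)

  -- For x v b with b ∉ U, the face row also contains partner b ∈ U, whose coordinate
  -- has the larger rank 2.
  faceRowOf-avoids : ∀ {a b a′ b′} → (a , b) ∈ coords → (a′ , b′) ∈ coords → (k : CoordKind a b) (k′ : CoordKind a′ b′) →
    a ≢ b → a′ ≢ b′ → (a′ , b′) ≢ (a , b) → rank k ℕ.≤ rank k′ → a ≡ v → ¬ T (faceRowOf k′ b)
  faceRowOf-avoids c∈ c′∈ k (irrelevant _)       _ _ _ _ _ ()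
  faceRowOf-avoids c∈ c′∈ k (diag-v _)           _ _ _ _ _ ()
  faceRowOf-avoids c∈ c′∈ k (diag-viaV _ _ _ _)  _ b≢b _ _ _ _ = b≢b refl
  faceRowOf-avoids c∈ c′∈ k (diag-other _ _ _ _) _ b≢b _ _ _ _ = b≢b refl
  faceRowOf-avoids c∈ c′∈ k (off-row _ _ _ _)    a≢b _ _ _ a≡v = faceRow₀-avoids c∈ a≢b a≡v
  faceRowOf-avoids {a} {b} c∈ c′∈ k (row-v b′ b′∈N⁺) a≢b _ c′≢c k≤k′ a≡v b∈ with faceRow-cases b∈
  ... | inj₁ b≡b′           = c′≢c (cong₂ _,_ (sym a≡v) (sym b≡b′))
  ... | inj₂ (b′∉U , refl) = too-high a≡v k k≤k′
    where
    too-high : a ≡ v → (k : CoordKind a b) → rank k ℕ.≤ rank (row-v b′ b′∈N⁺) → ⊥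
    too-high refl k k≤k′ with ℕ.≤-trans (rank-row-v∈U k (coords⇒relevant c∈) a≢b (proj₁ (partner-correct b′∈N⁺ b′∉U))) k≤k′
    ... | 2≤rank rewrite b′∉U = ℕ.<-irrefl refl 2≤rank

  module FaceFamily = Triangular (_∈ coords) coords⇒relevant faceRowOf (faceRow u₀)
                           (λ _ ()) faceRow₀-avoids faceRowOf-avoids

module FaceDimension {n : ℕ} (I : Instance n) (v : Fin n) (U : Fin n → Bool) (α : Fin n → ℕ)
  (v∉T : inT I v ≡ false) (U⊆N⁺ : _⊆ᵇ_ I U (inNp I v))
  (α-max : ∀ u → T (U u) → IsMaxStableThrough I U u (α u)) (U-max : MaximalCliqueIn I (inNp I v) U) where
  open Instance I
  open Construction I v U v∉T U⊆N⁺ U-max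

  Face : Point I → Set
  Face pt = InP I pt × extLHS I v U α pt ≡ γ I v pt

  γ≡if : ∀ {y x} → inS I v ≡ true ⊎ x v v ≡ 1ℚ → γ I v (y , x) ≡ 1ℚ
  γ≡if v∈S⊎xvv≡1 with inS I v
  γ≡if _             | true  = refl
  γ≡if (inj₂ xvv≡1) | false = xvv≡1

  γ-∉S : ∀ {y x} → inS I v ≡ false → γ I v (y , x) ≡ x v v
  γ-∉S v∉S with inS I v
  γ-∉S refl | false = refl

  γ≡1 : ∀ D R E Y → D v ≡ false → γ I v (boolPoint I Y (matrix I v D R E)) ≡ 1ℚ
  γ≡1 D R E Y v∉D with false-or-T (inS I v)
  ... | inj₂ v∈S = γ≡if {Y} {proj₂ (boolPoint I Y (matrix I v D R E))} (inj₁ (T⇒≡true v∈S))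
  ... | inj₁ v∉S = γ≡if {Y} {proj₂ (boolPoint I Y (matrix I v D R E))} (inj₂ (cong bool→ℚ (T⇒≡true (ShapeOf.matrix-diagonal I v D R E (∉S⇒relevant I v∉S) v∉D))))

  -- Row v meets U only in the single element of faceRow t ∩ U, and α is 1 there.
  faceEquation-row : ∀ D E t → T (inNp I v t) → (∀ u → T (U u) → T (E v u) → T (faceRow t u)) → D v ≡ false →
    ∀ Y → extLHS I v U α (boolPoint I Y (matrix I v D (faceRow t) E)) ≡ γ I v (boolPoint I Y (matrix I v D (faceRow t) E))
  faceEquation-row D E t t∈N⁺ E⊆faceRow v∉D Y with faceRow∩U t t∈N⁺
  ... | s , s∈U , s∈row , only-s = trans (sumℚ-single f s f≡0) (trans f-s≡1 (sym (γ≡1 D (faceRow t) E Y v∉D)))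
    where
    B = matrix I v D (faceRow t) E
    f : Fin n → ℚ
    f u = if U u then inv (α u) * bool→ℚ (B v u) else 0ℚ
    f≡0 : ∀ u → u ≢ s → f u ≡ 0ℚ
    f≡0 u u≢s with false-or-T (U u)
    ... | inj₁ u∉U rewrite u∉U = refl
    ... | inj₂ u∈U rewrite T⇒≡true u∈U = trans (cong (λ b → inv (α u) * bool→ℚ b) (¬T⇒≡false off)) (ℚ.*-zeroʳ (inv (α u)))
      where
      off : ¬ T (B v u)
      off Bvu with ShapeOf.matrix-cases I v D (faceRow t) E Bvu
      ... | inj₁ (v≡u , _)         = inNp⇒≢ I (U⊆N⁺ u u∈U) v≡u
      ... | inj₂ (inj₁ (_ , u∈row)) = u≢s (only-s u u∈U u∈row)
      ... | inj₂ (inj₂ Evu)         = u≢s (only-s u u∈U (E⊆faceRow u u∈U Evu))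
    f-s≡1 : f s ≡ 1ℚ
    f-s≡1 rewrite T⇒≡true s∈U | clique⇒α≡1 I U α α-max (proj₁ (proj₂ U-max)) s s∈U
                | T⇒≡true (ShapeOf.matrix-row I v D (faceRow t) E (inNm⇒relevant I (U⊆N⁺ s s∈U)) s∈row) = refl

  -- Dropping x v v empties row v: both sides vanish.
  faceEquation-diag-v : ∀ v∉S Y → extLHS I v U α (boolPoint I Y (FaceFamily.pointMatrix (diag-v v∉S)))
                                  ≡ γ I v (boolPoint I Y (FaceFamily.pointMatrix (diag-v v∉S)))
  faceEquation-diag-v v∉S Y = trans (sumℚ-≡0 f f≡0) (sym γ≡0)
    where
    k = diag-v v∉S
    B = FaceFamily.pointMatrix k
    row-off : ∀ u → ¬ T (B v u)
    row-off u Bvu with FaceFamily.point-cases k Bvu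
    ... | inj₁ (refl , v∉D) = ≡false⇒¬T v∉D (=ᵇ-refl v)
    ... | inj₂ (inj₂ E)     = cover≢ v∉S (sym (proj₁ (single-cases (cover v) v v u E)))
    f : Fin n → ℚ
    f u = if U u then inv (α u) * bool→ℚ (B v u) else 0ℚ
    f≡0 : ∀ u → f u ≡ 0ℚ
    f≡0 u with U u
    ... | false = refl
    ... | true  = trans (cong (λ b → inv (α u) * bool→ℚ b) (¬T⇒≡false (row-off u))) (ℚ.*-zeroʳ (inv (α u)))
    γ≡0 : γ I v (boolPoint I Y B) ≡ 0ℚ
    γ≡0 = trans (γ-∉S {Y} {proj₂ (boolPoint I Y B)} v∉S) (cong bool→ℚ (¬T⇒≡false (row-off v)))

  single-row⊆faceRow : ∀ a b (u : Fin n) → T (single a b v u) → T (faceRow b u)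
  single-row⊆faceRow a b u s = subst (λ z → T (faceRow b z)) (sym (proj₂ (single-cases a b v u s))) (faceRow-self b)

  faceEquation : ∀ {a b} (k : CoordKind a b) → (a , b) ∈ coords →
    ∀ Y → extLHS I v U α (boolPoint I Y (FaceFamily.pointMatrix k)) ≡ γ I v (boolPoint I Y (FaceFamily.pointMatrix k))
  faceEquation (irrelevant irr) c∈ Y = ⊥-elim (≡false⇒¬T irr (coords⇒relevant c∈))
  faceEquation (diag-v v∉S)     c∈ Y = faceEquation-diag-v v∉S Y
  faceEquation k@(diag-viaV b b≢v b∉S cover≡v) c∈ =
    faceEquation-row (dropped k) (extra k) b (cover-v∈N⁻ b b∉S cover≡v)
                     (λ u _ → single-row⊆faceRow v b u) (≢⇒=ᵇ≡false (b≢v ∘ sym))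
  faceEquation k@(diag-other b b≢v _ cover≢v) c∈ =
    faceEquation-row (dropped k) (extra k) u₀ u₀∈N⁺
                     (λ u _ s → ⊥-elim (cover≢v (sym (proj₁ (single-cases (cover b) b v u s))))) (≢⇒=ᵇ≡false (b≢v ∘ sym))
  faceEquation k@(row-v b b∈N⁺) c∈ =
    faceEquation-row ∅ (extra k) b b∈N⁺ (λ u _ → single-row⊆faceRow v b u) refl
  faceEquation k@(off-row a b _ a≢v) c∈ =
    faceEquation-row ∅ (extra k) u₀ u₀∈N⁺ (λ u _ s → ⊥-elim (a≢v (sym (proj₁ (single-cases a b v u s))))) refl

  faceEquation-base : ∀ Y → extLHS I v U α (boolPoint I Y FaceFamily.baseMatrix) ≡ γ I v (boolPoint I Y FaceFamily.baseMatrix)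
  faceEquation-base = faceEquation-row ∅ ∅ₘ u₀ u₀∈N⁺ (λ _ _ ()) refl

  consistent⇒feasible : ∀ {D R E} → Consistent I v D R E → ∀ Y → yBound I ≤ Y →
    Feasible I (boolPoint I Y (matrix I v D R E))
  consistent⇒feasible consistent = admissible⇒feasible I (consistent⇒admissible I v consistent)

  yBound≤yBound+1 : yBound I ≤ yBound I + 1ℚ
  yBound≤yBound+1 = subst (_≤ yBound I + 1ℚ) (ℚ.+-identityʳ (yBound I)) (ℚ.+-monoʳ-≤ (yBound I) (ℚ.nonNegative⁻¹ 1ℚ))

  fullPoints : Fin (suc (suc (length allCoords))) → Point I
  fullPoints = family I allCoords (yBound I) FullFamily.baseMatrix FullFamily.pointOf

  fullPoints∈P : ∀ i → InP I (fullPoints i)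
  fullPoints∈P zero          = feasible⇒InP I (consistent⇒feasible consistent-fullBase (yBound I) ℚ.≤-refl)
  fullPoints∈P (suc zero)    = feasible⇒InP I (consistent⇒feasible consistent-fullBase (yBound I + 1ℚ) yBound≤yBound+1)
  fullPoints∈P (suc (suc j)) = feasible⇒InP I (consistent⇒feasible (consistent-full (kind a b)) (yBound I) ℚ.≤-refl)
    where a = proj₁ (lookup allCoords j) ; b = proj₂ (lookup allCoords j)

  facePoints : Fin (suc (suc (length coords))) → Point I
  facePoints = family I coords (yBound I) FaceFamily.baseMatrix FaceFamily.pointOf

  facePoints∈Face : ∀ i → Face (facePoints i)
  facePoints∈Face zero          = feasible⇒InP I (consistent⇒feasible consistent-faceBase (yBound I) ℚ.≤-refl)
                                , faceEquation-base (yBound I)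
  facePoints∈Face (suc zero)    = feasible⇒InP I (consistent⇒feasible consistent-faceBase (yBound I + 1ℚ) yBound≤yBound+1)
                                , faceEquation-base (yBound I + 1ℚ)
  facePoints∈Face (suc (suc j)) = feasible⇒InP I (consistent⇒feasible (consistent-face (kind a b)) (yBound I) ℚ.≤-refl)
                                , faceEquation (kind a b) (∈-lookup j) (yBound I)
    where a = proj₁ (lookup coords j) ; b = proj₂ (lookup coords j)

  γ-∈S : ∀ {y x} → inS I v ≡ true → γ I v (y , x) ≡ 1ℚ
  γ-∈S {y} {x} v∈S = γ≡if {y} {x} (inj₁ v∈S)

  vu₀? : ∀ a b → (a ≡ v × b ≡ u₀) ⊎ ¬ (a ≡ v × b ≡ u₀)
  vu₀? a b with toSum (a ≟ᶠ v) | toSum (b ≟ᶠ u₀)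
  ... | inj₁ a≡v | inj₁ b≡u₀ = inj₁ (a≡v , b≡u₀)
  ... | inj₂ a≢v | _          = inj₂ (a≢v ∘ proj₁)
  ... | _        | inj₂ b≢u₀ = inj₂ (b≢u₀ ∘ proj₂)

  Σμcoord : ∀ {m} → (Fin m → Point I) → (Fin m → ℚ) → Coord n → ℚ
  Σμcoord q μ c = sumℚ (λ i → μ i * coord (q i) c)

  Σμcoord-irrelevant : ∀ {m} (q : Fin m → Point I) → (∀ i → InP I (q i)) → ∀ μ a b →
    relevant I a b ≡ false → Σμcoord q μ (just (a , b)) ≡ 0ℚ
  Σμcoord-irrelevant q q∈P μ a b irr =
    sumℚ-≡0 _ (λ i → trans (cong (μ i *_) (InP⇒irrelevant≡0 I (q∈P i) a b irr)) (ℚ.*-zeroʳ (μ i)))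

  InP-determinedBy : DeterminedBy I (InP I) (nothing ∷ map just allCoords)
  InP-determinedBy q q∈P μ Σμ≡0 known nothing = known nothing (here refl)
  InP-determinedBy q q∈P μ Σμ≡0 known (just (a , b)) with false-or-T (relevant I a b)
  ... | inj₁ irr = Σμcoord-irrelevant q q∈P μ a b irr
  ... | inj₂ rel with vu₀? a b
  ...   | inj₁ (refl , refl) = known (just (v , u₀)) (there (here refl))
  ...   | inj₂ ≢vu₀          = known (just (a , b)) (there (there (∈-map⁺ just (∈coords⁺ rel ≢vu₀))))

  -- On the face, α u₀ = 1 turns the face equation into a formula for x v u₀.
  others : (Fin n → Fin n → ℚ) → ℚ
  others x = sumℚ (λ u → if u =ᵇ u₀ then 0ℚ else (if U u then inv (α u) * x v u else 0ℚ))

  face⇒x-vu₀ : ∀ {y x} → Face (y , x) → x v u₀ ≡ γ I v (y , x) - others x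
  face⇒x-vu₀ {y} {x} (_ , equation) = begin
    x v u₀                       ≡⟨ solve 2 (λ z o → z := z :+ o :- o) refl (x v u₀) (others x) ⟩
    x v u₀ + others x - others x ≡⟨ cong (λ z → z + others x - others x) (sym f-u₀) ⟩
    f u₀ + others x - others x   ≡⟨ cong (_- others x) (sym (sumℚ-split f u₀)) ⟩
    extLHS I v U α (y , x) - others x ≡⟨ cong (_- others x) equation ⟩
    γ I v (y , x) - others x     ∎
    where
    open ≡-Reasoning
    f : Fin n → ℚ
    f u = if U u then inv (α u) * x v u else 0ℚ
    f-u₀ : f u₀ ≡ x v u₀
    f-u₀ rewrite T⇒≡true u₀∈U | clique⇒α≡1 I U α α-max (proj₁ (proj₂ U-max)) u₀ u₀∈U = ℚ.*-identityˡ (x v u₀)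

  Σμγ≡0 : ∀ {m} (q : Fin m → Point I) μ → sumℚ μ ≡ 0ℚ → Σμcoord q μ (just (v , v)) ≡ 0ℚ →
    sumℚ (λ i → μ i * γ I v (q i)) ≡ 0ℚ
  Σμγ≡0 q μ Σμ≡0 Σμx-vv≡0 with false-or-T (inS I v)
  ... | inj₂ v∈S = trans (sumℚ-cong (λ i → trans (cong (μ i *_) (γ-∈S {proj₁ (q i)} {proj₂ (q i)} (T⇒≡true v∈S)))
                                                (ℚ.*-identityʳ (μ i)))) Σμ≡0
  ... | inj₁ v∉S = trans (sumℚ-cong (λ i → cong (μ i *_) (γ-∉S {proj₁ (q i)} {proj₂ (q i)} v∉S))) Σμx-vv≡0

  Σμothers≡0 : ∀ {m} (q : Fin m → Point I) μ → (∀ u → u ≢ u₀ → Σμcoord q μ (just (v , u)) ≡ 0ℚ) →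
    sumℚ (λ i → μ i * others (proj₂ (q i))) ≡ 0ℚ
  Σμothers≡0 {m} q μ Σμx-vu≡0 = trans (sumℚ-cong (λ i → sym (sumℚ-*ˡ (μ i) (g i))))
                                      (trans (sumℚ-comm (λ i u → μ i * g i u)) (sumℚ-≡0 _ Σμg≡0))
    where
    g : Fin m → Fin n → ℚ
    g i u = if u =ᵇ u₀ then 0ℚ else (if U u then inv (α u) * proj₂ (q i) v u else 0ℚ)
    Σμg≡0 : ∀ u → sumℚ (λ i → μ i * g i u) ≡ 0ℚ
    Σμg≡0 u with u =ᵇ u₀ in u=u₀
    ... | true  = sumℚ-≡0 _ (λ i → ℚ.*-zeroʳ (μ i))
    ... | false with U u
    ...   | false = sumℚ-≡0 _ (λ i → ℚ.*-zeroʳ (μ i))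
    ...   | true  = begin
      sumℚ (λ i → μ i * (inv (α u) * proj₂ (q i) v u))
        ≡⟨ sumℚ-cong (λ i → solve 3 (λ m a x → m :* (a :* x) := a :* (m :* x)) refl (μ i) (inv (α u)) (proj₂ (q i) v u)) ⟩
      sumℚ (λ i → inv (α u) * (μ i * proj₂ (q i) v u))
        ≡⟨ sumℚ-*ˡ (inv (α u)) (λ i → μ i * proj₂ (q i) v u) ⟩
      inv (α u) * Σμcoord q μ (just (v , u))
        ≡⟨ cong (inv (α u) *_) (Σμx-vu≡0 u (λ u≡u₀ → ≡false⇒¬T u=u₀ (subst (λ z → T (u =ᵇ z)) u≡u₀ (=ᵇ-refl u)))) ⟩
      inv (α u) * 0ℚ
        ≡⟨ ℚ.*-zeroʳ (inv (α u)) ⟩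
      0ℚ ∎
      where open ≡-Reasoning

  Face-determinedBy : DeterminedBy I Face (nothing ∷ map just coords)
  Face-determinedBy {m} q q∈Face μ Σμ≡0 known = determined
    where
    x : Fin m → Fin n → Fin n → ℚ
    x i = proj₂ (q i)
    known′ : ∀ a b → ¬ (a ≡ v × b ≡ u₀) → Σμcoord q μ (just (a , b)) ≡ 0ℚ
    known′ a b ≢vu₀ with false-or-T (relevant I a b)
    ... | inj₁ irr = Σμcoord-irrelevant q (proj₁ ∘ q∈Face) μ a b irr
    ... | inj₂ rel = known (just (a , b)) (there (∈-map⁺ just (∈coords⁺ rel ≢vu₀)))
    Σμx-vu₀≡0 : Σμcoord q μ (just (v , u₀)) ≡ 0ℚ
    Σμx-vu₀≡0 = begin
      sumℚ (λ i → μ i * x i v u₀)                           ≡⟨ sumℚ-cong (λ i → cong (μ i *_) (face⇒x-vu₀ (q∈Face i))) ⟩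
      sumℚ (λ i → μ i * (γ I v (q i) - others (x i)))       ≡⟨ sumℚ-cong (λ i → *-distribˡ-sub (μ i) (γ I v (q i)) (others (x i))) ⟩
      sumℚ (λ i → μ i * γ I v (q i) - μ i * others (x i))   ≡⟨ sumℚ-distrib-sub (λ i → μ i * γ I v (q i)) (λ i → μ i * others (x i)) ⟩
      sumℚ (λ i → μ i * γ I v (q i)) - sumℚ (λ i → μ i * others (x i))
        ≡⟨ cong₂ _-_ (Σμγ≡0 q μ Σμ≡0 (known′ v v (λ (_ , v≡u₀) → inNp⇒≢ I u₀∈N⁺ v≡u₀)))
                     (Σμothers≡0 q μ (λ u u≢u₀ → known′ v u (u≢u₀ ∘ proj₂))) ⟩
      0ℚ - 0ℚ                                               ≡⟨⟩
      0ℚ                                                    ∎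
      where
      open ≡-Reasoning
      *-distribˡ-sub : ∀ a b c → a * (b - c) ≡ a * b - a * c
      *-distribˡ-sub = solve 3 (λ a b c → a :* (b :- c) := a :* b :- a :* c) refl
    determined : ∀ c → Σμcoord q μ c ≡ 0ℚ
    determined nothing = known nothing (here refl)
    determined (just (a , b)) with vu₀? a b
    ... | inj₁ (refl , refl) = Σμx-vu₀≡0
    ... | inj₂ ≢vu₀          = known′ a b ≢vu₀

  dim-P : Dim I (InP I) (suc (suc (length coords)))
  dim-P = (fullPoints , fullPoints∈P , FullFamily.family-indep allCoords allCoords-unique id (yBound I))
        , subst (λ l → ¬ HasAffIndep I (InP I) (suc (suc (suc (suc l))))) (List.length-map just coords)
                (¬HasAffIndep-determinedBy I (InP I) (nothing ∷ map just allCoords) InP-determinedBy)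

  dim-Face : Dim I Face (suc (length coords))
  dim-Face = (facePoints , facePoints∈Face , FaceFamily.family-indep coords coords-unique id (yBound I))
           , subst (λ l → ¬ HasAffIndep I Face (suc (suc (suc l)))) (List.length-map just coords)
                   (¬HasAffIndep-determinedBy I Face (nothing ∷ map just coords) Face-determinedBy)

  external-facet : FacetP I (extLHS I v U α) (γ I v)
  external-facet = external-valid I U α α-max v v∉T U⊆N⁺ , suc (length coords) , dim-P , dim-Face

corollary1 : ∀ {n} (I : Instance n) (v : Fin n) (U : Fin n → Bool) (α : Fin n → ℕ) →
    inT I v ≡ false →
    _⊆ᵇ_ I U (inNp I v) →
    (∀ u → T (U u) → IsMaxStableThrough I U u (α u)) →
    ValidP I (extLHS I v U α) (γ I v)
    × (MaximalCliqueIn I (inNp I v) U → FacetP I (extLHS I v U α) (γ I v))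
corollary1 I v U α v∉T U⊆N⁺ α-max =
  external-valid I U α α-max v v∉T U⊆N⁺ , FaceDimension.external-facet I v U α v∉T U⊆N⁺ α-max
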